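{- As formal power series in $q$ (and for $|q|<1$), \[ \sum_{n\ge0} r_{1,1}(n)q^n=\sum_{n\ge0}\frac{n q^{n^2}}{(q;q)_n},\qquad \sum_{n\ge0} r_{2,1}(n)q^n=\frac{1}{(q,q^4;q^5)_\infty}\cdot\frac{q+q^4}{1-q^5}. \]
   Context: $(a;q)_n=\prod_{i=0}^{n-1}(1-aq^i)$, $(a;q)_\infty=\prod_{i\ge0}(1-aq^i)$, and $(a_1,a_2;q)_\infty=(a_1;q)_\infty(a_2;q)_\infty$. A partition $\lambda=(\lambda_1\ge\cdots\ge\lambda_k)$ has conjugate $\lambda'$ with $\lambda'_j=\#\{i:\lambda_i\ge j\}$; the hook length of cell $(i,j)$ is $\lambda_i+\lambda'_j-i-j+1$, and a $t$-hook is a cell of hook length $t$. $r_{1,1}(n)$ is the total number of $1$-hooks over all partitions of $n$ whose consecutive parts differ by at least $2$; $r_{2,1}(n)$ is the total number of $1$-hooks over all partitions of $n$ with all parts congruent to $1$ or $4$ modulo $5$. -}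

module Defs where

open import Data.Nat as ℕ using (ℕ; zero; suc; _≤_; _<_; _%_; _≤?_)
open import Data.Nat.Properties using () renaming (_≟_ to _≟ℕ_)
open import Data.Integer as ℤ using (ℤ; +_; -_)
open import Data.List using (List; []; _∷_; length; filter; upTo; map; zipWith; concat; foldr; head)
import Data.List as L
open import Data.List.Relation.Unary.All using (All)
open import Data.List.Relation.Unary.Linked using (Linked)
open import Data.List.Relation.Unary.Unique.Propositional using (Unique)
open import Data.List.Membership.Propositional using (_∈_)
open import Data.Maybe using (just; nothing)
open import Data.Product using (_×_; _,_)
open import Data.Sum using (_⊎_)
open import Function.Bundles using (_⇔_)
open import Relation.Nullary using (yes; no)
open import Data.Nat.ListAction using (sum)
open import Relation.Binary.PropositionalEquality using (_≡_)

IsPartitionOf : ℕ → List ℕ → Set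
IsPartitionOf n λ′ = All (λ a → 0 < a) λ′ × Linked (λ a b → b ≤ a) λ′ × sum λ′ ≡ n

Gap2 : List ℕ → Set
Gap2 = Linked (λ a b → b ℕ.+ 2 ≤ a)

Parts14mod5 : List ℕ → Set
Parts14mod5 = All (λ a → a % 5 ≡ 1 ⊎ a % 5 ≡ 4)

conj : List ℕ → ℕ → ℕ
conj λ′ j = length (filter (λ a → j ≤? a) λ′)

-- cells as triples (i , λ_i , j) with 1 ≤ i ≤ length λ, 1 ≤ j ≤ λ_i
cells : List ℕ → List (ℕ × ℕ × ℕ)
cells λ′ = concat (zipWith (λ i a → map (λ j → (suc i , a , suc j)) (upTo a))
                           (upTo (length λ′)) λ′)

-- hook length λ_i + λ'_j - i - j + 1  (exact in ℕ since λ_i ≥ j, λ'_j ≥ i)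
hookLength : List ℕ → ℕ × ℕ × ℕ → ℕ
hookLength λ′ (i , a , j) = (a ℕ.+ conj λ′ j ℕ.+ 1) ℕ.∸ (i ℕ.+ j)

numHooks : ℕ → List ℕ → ℕ
numHooks t λ′ = length (filter (λ c → hookLength λ′ c ≟ℕ t) (cells λ′))

Enumerates : (List ℕ → Set) → List (List ℕ) → Set
Enumerates P Ls = Unique Ls × (∀ μ → (μ ∈ Ls) ⇔ P μ)

Series : Set
Series = ℕ → ℤ

sumℤ : List ℤ → ℤ
sumℤ = foldr ℤ._+_ (+ 0)

one : Series
one zero = + 1
one (suc _) = + 0

mono : ℤ → ℕ → Series
mono c k n with n ≟ℕ k
... | yes _ = c
... | no _ = + 0

_+ₛ_ : Series → Series → Series
(f +ₛ g) n = f n ℤ.+ g n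

_-ₛ_ : Series → Series → Series
(f -ₛ g) n = f n ℤ.- g n

_*ₛ_ : Series → Series → Series
(f *ₛ g) n = sumℤ (map (λ k → f k ℤ.* g (n ℕ.∸ k)) (upTo (suc n)))

prodₛ : ℕ → (ℕ → Series) → Series
prodₛ zero F = one
prodₛ (suc m) F = prodₛ m F *ₛ F m

-- Reciprocal of a series with constant term 1:
-- g_0 = 1, g_N = - Σ_{k=1}^{N} f_k g_{N-k}.
-- invRev f N = [g_N , g_{N-1} , … , g_0]
invRev : Series → ℕ → List ℤ
invRev f zero = + 1 ∷ []
invRev f (suc N) =
  let gs = invRev f N in
  (- sumℤ (zipWith ℤ._*_ (map (λ i → f (suc i)) (upTo (suc N))) gs)) ∷ gs

inv : Series → Series
inv f N with invRev f N
... | [] = + 0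
... | g ∷ _ = g

qPoch : ℕ → ℕ → ℕ → Series
qPoch c d m = prodₛ m (λ i → one -ₛ mono (+ 1) (c ℕ.+ d ℕ.* i))

-- (q^c ; q^d)_∞ as a formal power series (d ≥ 1, c ≥ 1): the N-th coefficient
-- is that of the finite product with N+1 factors (all further factors are ≡ 1 mod q^{N+1}).
qPochInf : ℕ → ℕ → Series
qPochInf c d N = qPoch c d (suc N) N

qq : ℕ → Series
qq n = qPoch 1 1 n

-- Σ_{n≥0} n q^{n²} / (q;q)_n ; the n-th term has order n² ≥ n, so only n ≤ N
-- contribute to the coefficient of q^N.
rhs1 : Series
rhs1 N = sumℤ (map (λ n → (mono (+ n) (n ℕ.* n) *ₛ inv (qq n)) N) (upTo (suc N)))

rhs2 : Series
rhs2 = inv (qPochInf 1 5 *ₛ qPochInf 4 5)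
       *ₛ ((mono (+ 1) 1 +ₛ mono (+ 1) 4) *ₛ inv (one -ₛ mono (+ 1) 5))

{-# OPTIONS --safe #-}
module Submission where

-- A cell has hook length 1 exactly when it ends a row that is longer than the next row, so the
-- number of 1-hooks of λ is its number of distinct parts.  Every count is a sum over an
-- explicit enumeration, and any two enumerations of the same finite set are permutations of each
-- other, so the counts do not depend on the enumeration chosen.
--
-- Parts differing by at least 2 are distinct, so the first sum counts such partitions weighted
-- by their number of parts n.  Those with n + 1 parts either have all parts ≥ 2 (subtract 1 from
-- every part) or smallest part 1 (delete it and subtract 2 from the others), so their generating
-- function satisfies G (n+1) = q^(n+1) G (n+1) + q^(2n+1) G n, as does q^((n+1)²)/(q;q)_(n+1).
--
-- For parts from a set S, splitting off a largest part b+1 shows that the number C b and the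
-- distinct-part total D b of partitions with parts in S and at most b satisfy
-- C (b+1) = C b + [b+1 ∈ S] q^(b+1) C (b+1) and D (b+1) = D b + [b+1 ∈ S] q^(b+1) (C b + D (b+1)),
-- whose solutions are 1/∏_{s≤b, s∈S} (1 - q^s) and that series times Σ_{s≤b, s∈S} q^s.  For
-- S = {s ≡ ±1 mod 5} the latter sum is (q + q⁴)/(1 - q⁵) up to degree b, and up to degree N only the
-- factors (1 - q^s) with s ≤ N of the infinite product matter.
--
-- Each recurrence has the shape X = Y + c q^(m+1) X, which determines X coefficientwise.

open import Defs
open import Data.Nat using (ℕ)
open import Relation.Unary using (Decidable)

module PowerSeries where

  open import Data.Nat as ℕ using (ℕ; zero; suc; _≤_; _<_; z≤n; s≤s; _∸_)
  import Data.Nat.Properties as ℕP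
  open import Data.Integer using (ℤ; +_; -_) renaming (_+_ to _+ᶻ_; _*_ to _*ᶻ_; _-_ to _-ᶻ_)
  import Data.Integer.Properties as ℤP
  open import Algebra.Properties.CommutativeSemigroup ℤP.+-commutativeSemigroup using (interchange)
  open import Data.Integer.Tactic.RingSolver using (solve-∀)
  open import Data.List using ([]; _∷_; map; upTo; applyUpTo; zipWith)
  import Data.List.Properties as LP
  open import Data.Sum using (inj₁; inj₂)
  open import Function using (id; _∘_)
  open import Relation.Binary.PropositionalEquality
  open import Relation.Nullary using (Dec; yes; no; contradiction)

  sumBelow : ℕ → (ℕ → ℤ) → ℤ
  sumBelow zero    h = + 0
  sumBelow (suc n) h = h 0 +ᶻ sumBelow n (λ k → h (suc k))

  sumℤ-map-applyUpTo : ∀ (h : ℕ → ℤ) g n → sumℤ (map h (applyUpTo g n)) ≡ sumBelow n (λ k → h (g k))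
  sumℤ-map-applyUpTo h g zero    = refl
  sumℤ-map-applyUpTo h g (suc n) = cong (h (g 0) +ᶻ_) (sumℤ-map-applyUpTo h (λ k → g (suc k)) n)

  sumℤ-map-upTo : ∀ (h : ℕ → ℤ) n → sumℤ (map h (upTo n)) ≡ sumBelow n h
  sumℤ-map-upTo h = sumℤ-map-applyUpTo h id

  sumBelow-cong : ∀ n {h h′ : ℕ → ℤ} → (∀ k → k < n → h k ≡ h′ k) → sumBelow n h ≡ sumBelow n h′
  sumBelow-cong zero    eq = refl
  sumBelow-cong (suc n) eq = cong₂ _+ᶻ_ (eq 0 (s≤s z≤n)) (sumBelow-cong n (λ k k<n → eq (suc k) (s≤s k<n)))

  sumBelow-+ : ∀ n (h h′ : ℕ → ℤ) → sumBelow n (λ k → h k +ᶻ h′ k) ≡ sumBelow n h +ᶻ sumBelow n h′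
  sumBelow-+ zero    h h′ = refl
  sumBelow-+ (suc n) h h′ = trans (cong (h 0 +ᶻ h′ 0 +ᶻ_) (sumBelow-+ n _ _)) (interchange (h 0) (h′ 0) _ _)

  sumBelow-neg : ∀ n (h : ℕ → ℤ) → sumBelow n (λ k → - h k) ≡ - sumBelow n h
  sumBelow-neg zero    h = refl
  sumBelow-neg (suc n) h = trans (cong (- h 0 +ᶻ_) (sumBelow-neg n _)) (sym (ℤP.neg-distrib-+ (h 0) _))

  sumBelow-*ˡ : ∀ n c (h : ℕ → ℤ) → sumBelow n (λ k → c *ᶻ h k) ≡ c *ᶻ sumBelow n h
  sumBelow-*ˡ zero    c h = sym (ℤP.*-zeroʳ c)
  sumBelow-*ˡ (suc n) c h = trans (cong (c *ᶻ h 0 +ᶻ_) (sumBelow-*ˡ n c _)) (sym (ℤP.*-distribˡ-+ c (h 0) _))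

  sumBelow-zero : ∀ n → sumBelow n (λ _ → + 0) ≡ + 0
  sumBelow-zero zero    = refl
  sumBelow-zero (suc n) = trans (ℤP.+-identityˡ _) (sumBelow-zero n)

  sumBelow-suc : ∀ n (h : ℕ → ℤ) → sumBelow (suc n) h ≡ sumBelow n h +ᶻ h n
  sumBelow-suc zero    h = trans (ℤP.+-identityʳ (h 0)) (sym (ℤP.+-identityˡ (h 0)))
  sumBelow-suc (suc n) h = trans (cong (h 0 +ᶻ_) (sumBelow-suc n (λ k → h (suc k))))
                                 (sym (ℤP.+-assoc (h 0) _ _))

  sumBelow-reverse : ∀ n (h : ℕ → ℤ) → sumBelow n h ≡ sumBelow n (λ k → h (n ∸ suc k))
  sumBelow-reverse zero    h = refl
  sumBelow-reverse (suc n) h = begin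
      h 0 +ᶻ sumBelow n (λ k → h (suc k))
    ≡⟨ cong (h 0 +ᶻ_) (sumBelow-reverse n (λ k → h (suc k))) ⟩
      h 0 +ᶻ sumBelow n (λ k → h (suc (n ∸ suc k)))
    ≡⟨ cong (h 0 +ᶻ_) (sumBelow-cong n (λ k k<n → cong h (sym (ℕP.+-∸-assoc 1 k<n)))) ⟩
      h 0 +ᶻ sumBelow n (λ k → h (n ∸ k))
    ≡⟨ ℤP.+-comm (h 0) _ ⟩
      sumBelow n (λ k → h (n ∸ k)) +ᶻ h 0
    ≡⟨ cong (λ z → sumBelow n (λ k → h (n ∸ k)) +ᶻ h z) (sym (ℕP.n∸n≡0 n)) ⟩
      sumBelow n (λ k → h (n ∸ k)) +ᶻ h (n ∸ n)
    ≡⟨ sym (sumBelow-suc n (λ k → h (n ∸ k))) ⟩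
      sumBelow (suc n) (λ k → h (n ∸ k))
    ∎
    where open ≡-Reasoning

  zeroₛ : Series
  zeroₛ _ = + 0

  infixl 7 _·ₛ_
  _·ₛ_ : ℤ → Series → Series
  (c ·ₛ f) n = c *ᶻ f n

  *ₛ-coeff : ∀ f g n → (f *ₛ g) n ≡ sumBelow (suc n) (λ k → f k *ᶻ g (n ∸ k))
  *ₛ-coeff f g n = sumℤ-map-upTo (λ k → f k *ᶻ g (n ∸ k)) (suc n)

  *ₛ-coeff-zero : ∀ f g → (f *ₛ g) 0 ≡ f 0 *ᶻ g 0
  *ₛ-coeff-zero f g = ℤP.+-identityʳ _

  *ₛ-coeff-suc : ∀ f g n → (f *ₛ g) (suc n) ≡ f 0 *ᶻ g (suc n) +ᶻ ((λ k → f (suc k)) *ₛ g) n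
  *ₛ-coeff-suc f g n = trans (*ₛ-coeff f g (suc n))
    (cong (f 0 *ᶻ g (suc n) +ᶻ_) (sym (*ₛ-coeff (λ k → f (suc k)) g n)))

  *ₛ-local : ∀ {f f′ g g′} n → (∀ k → k ≤ n → f k ≡ f′ k) → (∀ k → k ≤ n → g k ≡ g′ k) →
             (f *ₛ g) n ≡ (f′ *ₛ g′) n
  *ₛ-local {f} {f′} {g} {g′} n f≡ g≡ = begin
      (f *ₛ g) n
    ≡⟨ *ₛ-coeff f g n ⟩
      sumBelow (suc n) (λ k → f k *ᶻ g (n ∸ k))
    ≡⟨ sumBelow-cong (suc n) (λ k k<1+n → cong₂ _*ᶻ_ (f≡ k (ℕP.≤-pred k<1+n)) (g≡ (n ∸ k) (ℕP.m∸n≤m n k))) ⟩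
      sumBelow (suc n) (λ k → f′ k *ᶻ g′ (n ∸ k))
    ≡⟨ sym (*ₛ-coeff f′ g′ n) ⟩
      (f′ *ₛ g′) n
    ∎
    where open ≡-Reasoning

  *ₛ-congˡ : ∀ {f f′} g → f ≗ f′ → (f *ₛ g) ≗ (f′ *ₛ g)
  *ₛ-congˡ {f} {f′} g f≗f′ n = *ₛ-local {f} {f′} {g} {g} n (λ k _ → f≗f′ k) (λ _ _ → refl)

  *ₛ-congʳ : ∀ f {g g′} → g ≗ g′ → (f *ₛ g) ≗ (f *ₛ g′)
  *ₛ-congʳ f {g} {g′} g≗g′ n = *ₛ-local {f} {f} {g} {g′} n (λ _ _ → refl) (λ k _ → g≗g′ k)

  *ₛ-comm : ∀ f g → (f *ₛ g) ≗ (g *ₛ f)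
  *ₛ-comm f g n = begin
      (f *ₛ g) n
    ≡⟨ *ₛ-coeff f g n ⟩
      sumBelow (suc n) (λ k → f k *ᶻ g (n ∸ k))
    ≡⟨ sumBelow-reverse (suc n) (λ k → f k *ᶻ g (n ∸ k)) ⟩
      sumBelow (suc n) (λ k → f (n ∸ k) *ᶻ g (n ∸ (n ∸ k)))
    ≡⟨ sumBelow-cong (suc n) (λ k k<1+n → trans (cong (λ z → f (n ∸ k) *ᶻ g z) (ℕP.m∸[m∸n]≡n (ℕP.≤-pred k<1+n)))
                                                (ℤP.*-comm (f (n ∸ k)) (g k))) ⟩
      sumBelow (suc n) (λ k → g k *ᶻ f (n ∸ k))
    ≡⟨ sym (*ₛ-coeff g f n) ⟩
      (g *ₛ f) n
    ∎
    where open ≡-Reasoning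

  *ₛ-distribʳ-+ₛ : ∀ f f′ g → ((f +ₛ f′) *ₛ g) ≗ ((f *ₛ g) +ₛ (f′ *ₛ g))
  *ₛ-distribʳ-+ₛ f f′ g n = begin
      ((f +ₛ f′) *ₛ g) n
    ≡⟨ *ₛ-coeff (f +ₛ f′) g n ⟩
      sumBelow (suc n) (λ k → (f k +ᶻ f′ k) *ᶻ g (n ∸ k))
    ≡⟨ sumBelow-cong (suc n) (λ k _ → ℤP.*-distribʳ-+ (g (n ∸ k)) (f k) (f′ k)) ⟩
      sumBelow (suc n) (λ k → f k *ᶻ g (n ∸ k) +ᶻ f′ k *ᶻ g (n ∸ k))
    ≡⟨ sumBelow-+ (suc n) (λ k → f k *ᶻ g (n ∸ k)) (λ k → f′ k *ᶻ g (n ∸ k)) ⟩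
      sumBelow (suc n) (λ k → f k *ᶻ g (n ∸ k)) +ᶻ sumBelow (suc n) (λ k → f′ k *ᶻ g (n ∸ k))
    ≡⟨ sym (cong₂ _+ᶻ_ (*ₛ-coeff f g n) (*ₛ-coeff f′ g n)) ⟩
      (f *ₛ g) n +ᶻ (f′ *ₛ g) n
    ∎
    where open ≡-Reasoning

  *ₛ-distribˡ-+ₛ : ∀ f g g′ → (f *ₛ (g +ₛ g′)) ≗ ((f *ₛ g) +ₛ (f *ₛ g′))
  *ₛ-distribˡ-+ₛ f g g′ n = trans (*ₛ-comm f (g +ₛ g′) n)
    (trans (*ₛ-distribʳ-+ₛ g g′ f n) (cong₂ _+ᶻ_ (*ₛ-comm g f n) (*ₛ-comm g′ f n)))

  *ₛ-distribʳ-minusₛ : ∀ f f′ g → ((f -ₛ f′) *ₛ g) ≗ ((f *ₛ g) -ₛ (f′ *ₛ g))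
  *ₛ-distribʳ-minusₛ f f′ g n = begin
      ((f -ₛ f′) *ₛ g) n
    ≡⟨ *ₛ-coeff (f -ₛ f′) g n ⟩
      sumBelow (suc n) (λ k → (f k -ᶻ f′ k) *ᶻ g (n ∸ k))
    ≡⟨ sumBelow-cong (suc n) (λ k _ → distrib (f k) (f′ k) (g (n ∸ k))) ⟩
      sumBelow (suc n) (λ k → f k *ᶻ g (n ∸ k) +ᶻ (- (f′ k *ᶻ g (n ∸ k))))
    ≡⟨ sumBelow-+ (suc n) (λ k → f k *ᶻ g (n ∸ k)) (λ k → - (f′ k *ᶻ g (n ∸ k))) ⟩
      sumBelow (suc n) (λ k → f k *ᶻ g (n ∸ k)) +ᶻ sumBelow (suc n) (λ k → - (f′ k *ᶻ g (n ∸ k)))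
    ≡⟨ cong (sumBelow (suc n) (λ k → f k *ᶻ g (n ∸ k)) +ᶻ_) (sumBelow-neg (suc n) (λ k → f′ k *ᶻ g (n ∸ k))) ⟩
      sumBelow (suc n) (λ k → f k *ᶻ g (n ∸ k)) -ᶻ sumBelow (suc n) (λ k → f′ k *ᶻ g (n ∸ k))
    ≡⟨ sym (cong₂ _-ᶻ_ (*ₛ-coeff f g n) (*ₛ-coeff f′ g n)) ⟩
      (f *ₛ g) n -ᶻ (f′ *ₛ g) n
    ∎
    where
    open ≡-Reasoning
    distrib : ∀ a b c → (a -ᶻ b) *ᶻ c ≡ a *ᶻ c +ᶻ (- (b *ᶻ c))
    distrib = solve-∀

  ·ₛ-*ₛ-assoc : ∀ c f g → ((c ·ₛ f) *ₛ g) ≗ (c ·ₛ (f *ₛ g))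
  ·ₛ-*ₛ-assoc c f g n = begin
      ((c ·ₛ f) *ₛ g) n
    ≡⟨ *ₛ-coeff (c ·ₛ f) g n ⟩
      sumBelow (suc n) (λ k → (c *ᶻ f k) *ᶻ g (n ∸ k))
    ≡⟨ sumBelow-cong (suc n) (λ k _ → ℤP.*-assoc c (f k) (g (n ∸ k))) ⟩
      sumBelow (suc n) (λ k → c *ᶻ (f k *ᶻ g (n ∸ k)))
    ≡⟨ sumBelow-*ˡ (suc n) c (λ k → f k *ᶻ g (n ∸ k)) ⟩
      c *ᶻ sumBelow (suc n) (λ k → f k *ᶻ g (n ∸ k))
    ≡⟨ cong (c *ᶻ_) (sym (*ₛ-coeff f g n)) ⟩
      c *ᶻ (f *ₛ g) n
    ∎
    where open ≡-Reasoning

  *ₛ-zeroˡ : ∀ g → (zeroₛ *ₛ g) ≗ zeroₛ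
  *ₛ-zeroˡ g n = trans (*ₛ-coeff zeroₛ g n)
    (trans (sumBelow-cong (suc n) (λ k _ → ℤP.*-zeroˡ (g (n ∸ k)))) (sumBelow-zero (suc n)))

  *ₛ-assoc : ∀ f g h → ((f *ₛ g) *ₛ h) ≗ (f *ₛ (g *ₛ h))
  *ₛ-assoc f g h zero = begin
      (f 0 *ᶻ g 0 +ᶻ + 0) *ᶻ h 0 +ᶻ + 0
    ≡⟨ cong (λ x → x *ᶻ h 0 +ᶻ + 0) (ℤP.+-identityʳ (f 0 *ᶻ g 0)) ⟩
      (f 0 *ᶻ g 0) *ᶻ h 0 +ᶻ + 0
    ≡⟨ cong (_+ᶻ + 0) (ℤP.*-assoc (f 0) (g 0) (h 0)) ⟩
      f 0 *ᶻ (g 0 *ᶻ h 0) +ᶻ + 0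
    ≡⟨ cong (λ x → f 0 *ᶻ x +ᶻ + 0) (sym (ℤP.+-identityʳ (g 0 *ᶻ h 0))) ⟩
      f 0 *ᶻ (g 0 *ᶻ h 0 +ᶻ + 0) +ᶻ + 0
    ∎
    where open ≡-Reasoning
  *ₛ-assoc f g h (suc n) = begin
      ((f *ₛ g) *ₛ h) (suc n)
    ≡⟨ *ₛ-coeff-suc (f *ₛ g) h n ⟩
      (f *ₛ g) 0 *ᶻ h (suc n) +ᶻ ((λ k → (f *ₛ g) (suc k)) *ₛ h) n
    ≡⟨ cong₂ _+ᶻ_ (cong (_*ᶻ h (suc n)) (*ₛ-coeff-zero f g)) (*ₛ-congˡ h (*ₛ-coeff-suc f g) n) ⟩
      (f 0 *ᶻ g 0) *ᶻ h (suc n) +ᶻ (((f 0 ·ₛ g⁺) +ₛ (f⁺ *ₛ g)) *ₛ h) n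
    ≡⟨ cong ((f 0 *ᶻ g 0) *ᶻ h (suc n) +ᶻ_) (*ₛ-distribʳ-+ₛ (f 0 ·ₛ g⁺) (f⁺ *ₛ g) h n) ⟩
      (f 0 *ᶻ g 0) *ᶻ h (suc n) +ᶻ (((f 0 ·ₛ g⁺) *ₛ h) n +ᶻ ((f⁺ *ₛ g) *ₛ h) n)
    ≡⟨ cong ((f 0 *ᶻ g 0) *ᶻ h (suc n) +ᶻ_) (cong₂ _+ᶻ_ (·ₛ-*ₛ-assoc (f 0) g⁺ h n) (*ₛ-assoc f⁺ g h n)) ⟩
      (f 0 *ᶻ g 0) *ᶻ h (suc n) +ᶻ (f 0 *ᶻ (g⁺ *ₛ h) n +ᶻ (f⁺ *ₛ (g *ₛ h)) n)
    ≡⟨ regroup (f 0) (g 0) (h (suc n)) _ _ ⟩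
      f 0 *ᶻ (g 0 *ᶻ h (suc n) +ᶻ (g⁺ *ₛ h) n) +ᶻ (f⁺ *ₛ (g *ₛ h)) n
    ≡⟨ cong (λ z → f 0 *ᶻ z +ᶻ (f⁺ *ₛ (g *ₛ h)) n) (sym (*ₛ-coeff-suc g h n)) ⟩
      f 0 *ᶻ (g *ₛ h) (suc n) +ᶻ (f⁺ *ₛ (g *ₛ h)) n
    ≡⟨ sym (*ₛ-coeff-suc f (g *ₛ h) n) ⟩
      (f *ₛ (g *ₛ h)) (suc n)
    ∎
    where
    open ≡-Reasoning
    f⁺ g⁺ : Series
    f⁺ k = f (suc k)
    g⁺ k = g (suc k)
    regroup : ∀ a b c x y → (a *ᶻ b) *ᶻ c +ᶻ (a *ᶻ x +ᶻ y) ≡ a *ᶻ (b *ᶻ c +ᶻ x) +ᶻ y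
    regroup = solve-∀

  *ₛ-interchange : ∀ A B F G → (((A *ₛ B) *ₛ F) *ₛ G) ≗ ((A *ₛ F) *ₛ (B *ₛ G))
  *ₛ-interchange A B F G n = begin
      (((A *ₛ B) *ₛ F) *ₛ G) n
    ≡⟨ *ₛ-congˡ G (*ₛ-assoc A B F) n ⟩
      ((A *ₛ (B *ₛ F)) *ₛ G) n
    ≡⟨ *ₛ-congˡ G (*ₛ-congʳ A (*ₛ-comm B F)) n ⟩
      ((A *ₛ (F *ₛ B)) *ₛ G) n
    ≡⟨ *ₛ-congˡ G (*ₛ-assoc A F B) n ⟨
      (((A *ₛ F) *ₛ B) *ₛ G) n
    ≡⟨ *ₛ-assoc (A *ₛ F) B G n ⟩
      ((A *ₛ F) *ₛ (B *ₛ G)) n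
    ∎
    where open ≡-Reasoning

  *ₛ-identityˡ : ∀ f → (one *ₛ f) ≗ f
  *ₛ-identityˡ f zero    = trans (*ₛ-coeff-zero one f) (ℤP.*-identityˡ (f 0))
  *ₛ-identityˡ f (suc n) = trans (*ₛ-coeff-suc one f n)
    (trans (cong₂ _+ᶻ_ (ℤP.*-identityˡ (f (suc n))) (*ₛ-zeroˡ f n)) (ℤP.+-identityʳ _))

  *ₛ-identityʳ : ∀ f → (f *ₛ one) ≗ f
  *ₛ-identityʳ f n = trans (*ₛ-comm f one n) (*ₛ-identityˡ f n)

  mono-≡ : ∀ c k → mono c k k ≡ c
  mono-≡ c k with k ℕP.≟ k
  ... | yes _  = refl
  ... | no k≢k = contradiction refl k≢k

  mono-≢ : ∀ c k n → n ≢ k → mono c k n ≡ + 0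
  mono-≢ c k n n≢k with n ℕP.≟ k
  ... | yes n≡k = contradiction n≡k n≢k
  ... | no _    = refl

  mono-suc : ∀ c k n → mono c (suc k) (suc n) ≡ mono c k n
  mono-suc c k n = by-cases (n ℕP.≟ k)
    where
    by-cases : Dec (n ≡ k) → mono c (suc k) (suc n) ≡ mono c k n
    by-cases (yes refl) = trans (mono-≡ c (suc n)) (sym (mono-≡ c n))
    by-cases (no n≢k)   = trans (mono-≢ c (suc k) (suc n) (n≢k ∘ ℕP.suc-injective)) (sym (mono-≢ c k n n≢k))

  shift : ℕ → Series → Series
  shift zero    f n       = f n
  shift (suc k) f zero    = + 0
  shift (suc k) f (suc n) = shift k f n

  shift-≥ : ∀ k f n → k ≤ n → shift k f n ≡ f (n ∸ k)
  shift-≥ zero    f n       _         = refl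
  shift-≥ (suc k) f (suc n) (s≤s k≤n) = shift-≥ k f n k≤n

  shift-< : ∀ k f n → n < k → shift k f n ≡ + 0
  shift-< (suc k) f zero    _         = refl
  shift-< (suc k) f (suc n) (s≤s n<k) = shift-< k f n n<k

  shift-local : ∀ k {f g} n → (∀ j → j ≤ n → f j ≡ g j) → shift k f n ≡ shift k g n
  shift-local zero    n       f≡g = f≡g n ℕP.≤-refl
  shift-local (suc k) zero    f≡g = refl
  shift-local (suc k) (suc n) f≡g = shift-local k n (λ j j≤n → f≡g j (ℕP.m≤n⇒m≤1+n j≤n))

  shift-cong : ∀ k {f g} → f ≗ g → shift k f ≗ shift k g
  shift-cong k f≗g n = shift-local k n (λ j _ → f≗g j)

  shift-+ₛ : ∀ k f g → shift k (f +ₛ g) ≗ (shift k f +ₛ shift k g)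
  shift-+ₛ zero    f g n       = refl
  shift-+ₛ (suc k) f g zero    = refl
  shift-+ₛ (suc k) f g (suc n) = shift-+ₛ k f g n

  shift-·ₛ : ∀ k c f → shift k (c ·ₛ f) ≗ (c ·ₛ shift k f)
  shift-·ₛ zero    c f n       = refl
  shift-·ₛ (suc k) c f zero    = sym (ℤP.*-zeroʳ c)
  shift-·ₛ (suc k) c f (suc n) = shift-·ₛ k c f n

  shift-shift : ∀ a b f → shift a (shift b f) ≗ shift (a ℕ.+ b) f
  shift-shift zero    b f n       = refl
  shift-shift (suc a) b f zero    = refl
  shift-shift (suc a) b f (suc n) = shift-shift a b f n

  shift-*ₛ : ∀ k f g → (shift k f *ₛ g) ≗ shift k (f *ₛ g)
  shift-*ₛ zero    f g n       = refl
  shift-*ₛ (suc k) f g zero    = trans (*ₛ-coeff-zero (shift (suc k) f) g) (ℤP.*-zeroˡ (g 0))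
  shift-*ₛ (suc k) f g (suc n) = begin
      (shift (suc k) f *ₛ g) (suc n)
    ≡⟨ *ₛ-coeff-suc (shift (suc k) f) g n ⟩
      + 0 *ᶻ g (suc n) +ᶻ (shift k f *ₛ g) n
    ≡⟨ cong (_+ᶻ (shift k f *ₛ g) n) (ℤP.*-zeroˡ (g (suc n))) ⟩
      + 0 +ᶻ (shift k f *ₛ g) n
    ≡⟨ ℤP.+-identityˡ _ ⟩
      (shift k f *ₛ g) n
    ≡⟨ shift-*ₛ k f g n ⟩
      shift k (f *ₛ g) n
    ∎
    where open ≡-Reasoning

  mono-*ₛ : ∀ c k f → (mono c k *ₛ f) ≗ (c ·ₛ shift k f)
  mono-*ₛ c zero f zero = trans (*ₛ-coeff-zero (mono c 0) f) (cong (_*ᶻ f 0) (mono-≡ c 0))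
  mono-*ₛ c zero f (suc n) = begin
      (mono c 0 *ₛ f) (suc n)
    ≡⟨ *ₛ-coeff-suc (mono c 0) f n ⟩
      mono c 0 0 *ᶻ f (suc n) +ᶻ ((λ j → mono c 0 (suc j)) *ₛ f) n
    ≡⟨ cong₂ _+ᶻ_ (cong (_*ᶻ f (suc n)) (mono-≡ c 0))
                  (trans (*ₛ-congˡ f (λ j → mono-≢ c 0 (suc j) λ ()) n) (*ₛ-zeroˡ f n)) ⟩
      c *ᶻ f (suc n) +ᶻ + 0
    ≡⟨ ℤP.+-identityʳ _ ⟩
      c *ᶻ f (suc n)
    ∎
    where open ≡-Reasoning
  mono-*ₛ c (suc k) f zero = begin
      (mono c (suc k) *ₛ f) 0
    ≡⟨ *ₛ-coeff-zero (mono c (suc k)) f ⟩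
      mono c (suc k) 0 *ᶻ f 0
    ≡⟨ cong (_*ᶻ f 0) (mono-≢ c (suc k) 0 λ ()) ⟩
      + 0 *ᶻ f 0
    ≡⟨ ℤP.*-zeroˡ (f 0) ⟩
      + 0
    ≡⟨ sym (ℤP.*-zeroʳ c) ⟩
      c *ᶻ + 0
    ∎
    where open ≡-Reasoning
  mono-*ₛ c (suc k) f (suc n) = begin
      (mono c (suc k) *ₛ f) (suc n)
    ≡⟨ *ₛ-coeff-suc (mono c (suc k)) f n ⟩
      mono c (suc k) 0 *ᶻ f (suc n) +ᶻ ((λ j → mono c (suc k) (suc j)) *ₛ f) n
    ≡⟨ cong₂ _+ᶻ_ (trans (cong (_*ᶻ f (suc n)) (mono-≢ c (suc k) 0 λ ())) (ℤP.*-zeroˡ (f (suc n))))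
                  (*ₛ-congˡ f (mono-suc c k) n) ⟩
      + 0 +ᶻ (mono c k *ₛ f) n
    ≡⟨ ℤP.+-identityˡ _ ⟩
      (mono c k *ₛ f) n
    ≡⟨ mono-*ₛ c k f n ⟩
      c *ᶻ shift k f n
    ∎
    where open ≡-Reasoning

  invRev≡ : ∀ f N → invRev f N ≡ map (λ i → inv f (N ∸ i)) (upTo (suc N))
  invRev≡ f zero    = refl
  invRev≡ f (suc N) = cong (inv f (suc N) ∷_)
    (trans (invRev≡ f N)
      (trans (LP.map-applyUpTo id (λ i → inv f (N ∸ i)) (suc N))
             (sym (LP.map-applyUpTo suc (λ i → inv f (suc N ∸ i)) (suc N)))))

  zipWith-map-map : ∀ {A B C D : Set} (h : B → C → D) (a : A → B) (b : A → C) xs →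
                    zipWith h (map a xs) (map b xs) ≡ map (λ x → h (a x) (b x)) xs
  zipWith-map-map h a b []       = refl
  zipWith-map-map h a b (x ∷ xs) = cong (h (a x) (b x) ∷_) (zipWith-map-map h a b xs)

  inv-suc : ∀ f N → inv f (suc N) ≡ - sumBelow (suc N) (λ i → f (suc i) *ᶻ inv f (N ∸ i))
  inv-suc f N = cong -_ (begin
      sumℤ (zipWith _*ᶻ_ (map (λ i → f (suc i)) (upTo (suc N))) (invRev f N))
    ≡⟨ cong (λ gs → sumℤ (zipWith _*ᶻ_ (map (λ i → f (suc i)) (upTo (suc N))) gs)) (invRev≡ f N) ⟩
      sumℤ (zipWith _*ᶻ_ (map (λ i → f (suc i)) (upTo (suc N))) (map (λ i → inv f (N ∸ i)) (upTo (suc N))))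
    ≡⟨ cong sumℤ (zipWith-map-map _*ᶻ_ (λ i → f (suc i)) (λ i → inv f (N ∸ i)) (upTo (suc N))) ⟩
      sumℤ (map (λ i → f (suc i) *ᶻ inv f (N ∸ i)) (upTo (suc N)))
    ≡⟨ sumℤ-map-upTo (λ i → f (suc i) *ᶻ inv f (N ∸ i)) (suc N) ⟩
      sumBelow (suc N) (λ i → f (suc i) *ᶻ inv f (N ∸ i))
    ∎)
    where open ≡-Reasoning

  *ₛ-inverseʳ : ∀ f → f 0 ≡ + 1 → (f *ₛ inv f) ≗ one
  *ₛ-inverseʳ f f₀≡1 zero    = trans (*ₛ-coeff-zero f (inv f)) (cong (_*ᶻ + 1) f₀≡1)
  *ₛ-inverseʳ f f₀≡1 (suc N) = begin
      (f *ₛ inv f) (suc N)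
    ≡⟨ *ₛ-coeff-suc f (inv f) N ⟩
      f 0 *ᶻ inv f (suc N) +ᶻ ((λ k → f (suc k)) *ₛ inv f) N
    ≡⟨ cong₂ _+ᶻ_ (cong₂ _*ᶻ_ f₀≡1 (inv-suc f N)) (*ₛ-coeff (λ k → f (suc k)) (inv f) N) ⟩
      + 1 *ᶻ (- S) +ᶻ S
    ≡⟨ cong (_+ᶻ S) (ℤP.*-identityˡ (- S)) ⟩
      - S +ᶻ S
    ≡⟨ ℤP.+-inverseˡ S ⟩
      + 0
    ∎
    where
    open ≡-Reasoning
    S : ℤ
    S = sumBelow (suc N) (λ i → f (suc i) *ᶻ inv f (N ∸ i))

  *ₛ-inverseˡ : ∀ f → f 0 ≡ + 1 → (inv f *ₛ f) ≗ one
  *ₛ-inverseˡ f f₀≡1 n = trans (*ₛ-comm (inv f) f n) (*ₛ-inverseʳ f f₀≡1 n)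

  inv-solve : ∀ f x y → f 0 ≡ + 1 → (f *ₛ x) ≗ y → x ≗ (inv f *ₛ y)
  inv-solve f x y f₀≡1 fx≗y n = begin
      x n
    ≡⟨ sym (*ₛ-identityˡ x n) ⟩
      (one *ₛ x) n
    ≡⟨ sym (*ₛ-congˡ x (*ₛ-inverseˡ f f₀≡1) n) ⟩
      ((inv f *ₛ f) *ₛ x) n
    ≡⟨ *ₛ-assoc (inv f) f x n ⟩
      (inv f *ₛ (f *ₛ x)) n
    ≡⟨ *ₛ-congʳ (inv f) fx≗y n ⟩
      (inv f *ₛ y) n
    ∎
    where open ≡-Reasoning

  inv-unique : ∀ f g → f 0 ≡ + 1 → (f *ₛ g) ≗ one → g ≗ inv f
  inv-unique f g f₀≡1 fg≗1 n = trans (inv-solve f g one f₀≡1 fg≗1 n) (*ₛ-identityʳ (inv f) n)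

  inv-one : inv one ≗ one
  inv-one n = sym (inv-unique one one refl (*ₛ-identityˡ one) n)

  inv-local : ∀ {f g} M → (∀ k → k ≤ M → f k ≡ g k) → ∀ j → j ≤ M → inv f j ≡ inv g j
  inv-local M f≡g zero _ = refl
  inv-local {f} {g} (suc M) f≡g (suc j) (s≤s j≤M) = begin
      inv f (suc j)
    ≡⟨ inv-suc f j ⟩
      - sumBelow (suc j) (λ i → f (suc i) *ᶻ inv f (j ∸ i))
    ≡⟨ cong -_ (sumBelow-cong (suc j) (λ i i<1+j → cong₂ _*ᶻ_
         (f≡g (suc i) (s≤s (ℕP.≤-trans (ℕP.≤-pred i<1+j) j≤M)))
         (inv-local M (λ k k≤M → f≡g k (ℕP.m≤n⇒m≤1+n k≤M)) (j ∸ i) (ℕP.≤-trans (ℕP.m∸n≤m j i) j≤M)))) ⟩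
      - sumBelow (suc j) (λ i → g (suc i) *ᶻ inv g (j ∸ i))
    ≡⟨ sym (inv-suc g j) ⟩
      inv g (suc j)
    ∎
    where open ≡-Reasoning

  prodₛ-coeff-zero : ∀ m F → (∀ i → F i 0 ≡ + 1) → prodₛ m F 0 ≡ + 1
  prodₛ-coeff-zero zero    F F₀≡1 = refl
  prodₛ-coeff-zero (suc m) F F₀≡1 =
    trans (*ₛ-coeff-zero (prodₛ m F) (F m)) (cong₂ _*ᶻ_ (prodₛ-coeff-zero m F F₀≡1) (F₀≡1 m))

  factor : ℤ → ℕ → Series
  factor c k = one -ₛ mono c k

  factor-coeff-zero : ∀ c k → factor c (suc k) 0 ≡ + 1
  factor-coeff-zero c k = cong (+ 1 -ᶻ_) (mono-≢ c (suc k) 0 λ ())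

  *ₛ-factor : ∀ f c k → (f *ₛ factor c k) ≗ (f -ₛ (c ·ₛ shift k f))
  *ₛ-factor f c k n = begin
      (f *ₛ factor c k) n
    ≡⟨ *ₛ-comm f (factor c k) n ⟩
      (factor c k *ₛ f) n
    ≡⟨ *ₛ-distribʳ-minusₛ one (mono c k) f n ⟩
      (one *ₛ f) n -ᶻ (mono c k *ₛ f) n
    ≡⟨ cong₂ _-ᶻ_ (*ₛ-identityˡ f n) (mono-*ₛ c k f n) ⟩
      f n -ᶻ c *ᶻ shift k f n
    ∎
    where open ≡-Reasoning

  *ₛ-factor-below : ∀ f c k n → n < k → (f *ₛ factor c k) n ≡ f n
  *ₛ-factor-below f c k n n<k = begin
      (f *ₛ factor c k) n
    ≡⟨ *ₛ-factor f c k n ⟩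
      f n -ᶻ c *ᶻ shift k f n
    ≡⟨ cong (λ z → f n -ᶻ c *ᶻ z) (shift-< k f n n<k) ⟩
      f n -ᶻ c *ᶻ + 0
    ≡⟨ cong (f n -ᶻ_) (ℤP.*-zeroʳ c) ⟩
      f n -ᶻ + 0
    ≡⟨ ℤP.+-identityʳ (f n) ⟩
      f n
    ∎
    where open ≡-Reasoning

  *ₛ-factor-trivial : ∀ f {c} k → c ≡ + 0 → (f *ₛ factor c k) ≗ f
  *ₛ-factor-trivial f k refl n = begin
      (f *ₛ factor (+ 0) k) n
    ≡⟨ *ₛ-factor f (+ 0) k n ⟩
      f n -ᶻ + 0 *ᶻ shift k f n
    ≡⟨ cong (f n -ᶻ_) (ℤP.*-zeroˡ (shift k f n)) ⟩
      f n -ᶻ + 0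
    ≡⟨ ℤP.+-identityʳ (f n) ⟩
      f n
    ∎
    where open ≡-Reasoning

  inv-*ₛ-cancelʳ : ∀ f g → f 0 ≡ + 1 → g 0 ≡ + 1 → (inv (f *ₛ g) *ₛ g) ≗ inv f
  inv-*ₛ-cancelʳ f g f₀≡1 g₀≡1 = inv-unique f (inv (f *ₛ g) *ₛ g) f₀≡1 (λ n → begin
      (f *ₛ (inv (f *ₛ g) *ₛ g)) n
    ≡⟨ *ₛ-congʳ f (*ₛ-comm (inv (f *ₛ g)) g) n ⟩
      (f *ₛ (g *ₛ inv (f *ₛ g))) n
    ≡⟨ *ₛ-assoc f g (inv (f *ₛ g)) n ⟨
      ((f *ₛ g) *ₛ inv (f *ₛ g)) n
    ≡⟨ *ₛ-inverseʳ (f *ₛ g) (trans (*ₛ-coeff-zero f g) (cong₂ _*ᶻ_ f₀≡1 g₀≡1)) n ⟩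
      one n
    ∎)
    where open ≡-Reasoning

  *ₛ-factor⇒recurrence : ∀ {X Y} c k → (X *ₛ factor c k) ≗ Y → X ≗ (Y +ₛ (c ·ₛ shift k X))
  *ₛ-factor⇒recurrence {X} {Y} c k X·F≗Y n = begin
      X n
    ≡⟨ cancel (X n) (c *ᶻ shift k X n) ⟩
      (X n -ᶻ c *ᶻ shift k X n) +ᶻ c *ᶻ shift k X n
    ≡⟨ cong (_+ᶻ c *ᶻ shift k X n) (trans (sym (*ₛ-factor X c k n)) (X·F≗Y n)) ⟩
      Y n +ᶻ c *ᶻ shift k X n
    ∎
    where
    open ≡-Reasoning
    cancel : ∀ x y → x ≡ (x -ᶻ y) +ᶻ y
    cancel = solve-∀

  shift-recurrence-unique : ∀ m c (Y X X′ : Series) →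
    X ≗ (Y +ₛ (c ·ₛ shift (suc m) X)) → X′ ≗ (Y +ₛ (c ·ₛ shift (suc m) X′)) → X ≗ X′
  shift-recurrence-unique m c Y X X′ X≗ X′≗ K = agree-below K K ℕP.≤-refl
    where
    agree-below : ∀ K j → j ≤ K → X j ≡ X′ j
    agree-below zero    zero _   = trans (X≗ 0) (sym (X′≗ 0))
    agree-below (suc K) j j≤1+K with ℕP.m≤n⇒m<n∨m≡n j≤1+K
    ... | inj₁ j<1+K = agree-below K j (ℕP.≤-pred j<1+K)
    ... | inj₂ refl  = trans (X≗ (suc K))
      (trans (cong (λ z → Y (suc K) +ᶻ c *ᶻ z) (shift-local m K (agree-below K))) (sym (X′≗ (suc K))))

  qPoch-stable : ∀ c d m k → k < m → qPoch c (suc d) m k ≡ qPochInf c (suc d) k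
  qPoch-stable c d (suc m) k k<1+m with ℕP.m≤n⇒m<n∨m≡n (ℕP.≤-pred k<1+m)
  ... | inj₂ refl = refl
  ... | inj₁ k<m  = trans (*ₛ-factor-below (qPoch c (suc d) m) (+ 1) (c ℕ.+ suc d ℕ.* m) k k<c+dm) (qPoch-stable c d m k k<m)
    where
    k<c+dm : k < c ℕ.+ suc d ℕ.* m
    k<c+dm = ℕP.<-≤-trans k<m (ℕP.≤-trans (ℕP.m≤n*m m (suc d)) (ℕP.m≤n+m (suc d ℕ.* m) c))

module Enumeration where

  open import Data.Nat using (ℕ; _+_; _*_; _∸_; _≤?_)
  import Data.Integer as ℤ
  open PowerSeries using (shift; shift-≥; shift-<)
  import Data.Nat.Properties as ℕP
  open import Algebra.Properties.CommutativeSemigroup ℕP.+-commutativeSemigroup using (interchange)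
  open import Data.List using (List; []; _∷_; _++_; map; filter; length)
  import Data.List.Properties as LP
  open import Data.Nat.ListAction using (sum)
  import Data.Nat.ListAction.Properties as SumP
  open import Data.List.Relation.Unary.Any using (here; there)
  open import Data.List.Relation.Unary.All using ([])
  open import Data.List.Relation.Unary.AllPairs using ([]; _∷_)
  import Data.List.Relation.Unary.Unique.Propositional.Properties as UniqueP
  open import Data.List.Membership.Propositional using (_∈_)
  import Data.List.Membership.Propositional.Properties as ∈P
  open import Data.List.Membership.Propositional.Properties.WithK using (unique∧set⇒bag)
  open import Data.List.Relation.Binary.BagAndSetEquality using (∼bag⇒↭)
  open import Data.List.Relation.Binary.Permutation.Propositional using (_↭_)
  import Data.List.Relation.Binary.Permutation.Propositional.Properties as ↭P
  open import Data.Product using (Σ; ∃; _×_; _,_; proj₁; proj₂)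
  open import Data.Sum as Sum using (_⊎_)
  open import Function using (_∘_)
  open import Function.Bundles using (_⇔_; mk⇔; Equivalence)
  open import Relation.Binary.PropositionalEquality
  open import Relation.Nullary using (¬_; Dec; yes; no; contradiction)
  open import Relation.Unary using (Decidable)

  open Equivalence

  Enumeration : (List ℕ → Set) → Set
  Enumeration P = Σ (List (List ℕ)) (Enumerates P)

  module _ {P : List ℕ → Set} {xs ys : List (List ℕ)} where

    enumerates-↭ : Enumerates P xs → Enumerates P ys → xs ↭ ys
    enumerates-↭ (xs! , ∈xs⇔P) (ys! , ∈ys⇔P) = ∼bag⇒↭ (unique∧set⇒bag xs! ys! (λ {μ} →
      mk⇔ (from (∈ys⇔P μ) ∘ to (∈xs⇔P μ)) (from (∈xs⇔P μ) ∘ to (∈ys⇔P μ))))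

    enumerates-sum : Enumerates P xs → Enumerates P ys → ∀ f → sum (map f xs) ≡ sum (map f ys)
    enumerates-sum exs eys f = SumP.sum-↭ (↭P.map⁺ f (enumerates-↭ exs eys))

    enumerates-length : Enumerates P xs → Enumerates P ys → length xs ≡ length ys
    enumerates-length exs eys = ↭P.↭-length (enumerates-↭ exs eys)

  enumerates-⇔ : ∀ {P Q : List ℕ → Set} {xs} → (∀ μ → P μ ⇔ Q μ) → Enumerates P xs → Enumerates Q xs
  enumerates-⇔ P⇔Q (xs! , ∈⇔P) = xs! , λ μ →
    mk⇔ (to (P⇔Q μ) ∘ to (∈⇔P μ)) (from (∈⇔P μ) ∘ from (P⇔Q μ))

  enumerates-[] : ∀ {P : List ℕ → Set} → (∀ μ → ¬ P μ) → Enumerates P []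
  enumerates-[] ¬P = [] , λ μ → mk⇔ (λ ()) (λ p → contradiction p (¬P μ))

  enumerates-[_] : ∀ {P : List ℕ → Set} ν → (∀ μ → P μ ⇔ μ ≡ ν) → Enumerates P (ν ∷ [])
  enumerates-[ ν ] P⇔≡ν = ([] ∷ []) , λ μ →
    mk⇔ (λ { (here refl) → from (P⇔≡ν μ) refl }) (here ∘ to (P⇔≡ν μ))

  enumerates-++ : ∀ {P Q : List ℕ → Set} {xs ys} → Enumerates P xs → Enumerates Q ys →
                  (∀ μ → P μ → ¬ Q μ) → Enumerates (λ μ → P μ ⊎ Q μ) (xs ++ ys)
  enumerates-++ {xs = xs} (xs! , ∈xs⇔P) (ys! , ∈ys⇔Q) P⇒¬Q =
    UniqueP.++⁺ xs! ys! (λ { {μ} (μ∈xs , μ∈ys) → P⇒¬Q μ (to (∈xs⇔P μ) μ∈xs) (to (∈ys⇔Q μ) μ∈ys) }) ,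
    λ μ → mk⇔ (Sum.map (to (∈xs⇔P μ)) (to (∈ys⇔Q μ)) ∘ ∈P.∈-++⁻ xs)
              (Sum.[ ∈P.∈-++⁺ˡ ∘ from (∈xs⇔P μ) , ∈P.∈-++⁺ʳ xs ∘ from (∈ys⇔Q μ) ])

  Image : (List ℕ → List ℕ) → (List ℕ → Set) → List ℕ → Set
  Image g P μ = ∃ λ ν → P ν × μ ≡ g ν

  enumerates-map : ∀ {P : List ℕ → Set} {xs} (g : List ℕ → List ℕ) → (∀ {μ ν} → g μ ≡ g ν → μ ≡ ν) →
                   Enumerates P xs → Enumerates (Image g P) (map g xs)
  enumerates-map g g-injective (xs! , ∈⇔P) =
    UniqueP.map⁺ g-injective xs! ,
    λ μ → mk⇔ (λ μ∈ → let (ν , ν∈ , μ≡gν) = ∈P.∈-map⁻ g μ∈ in ν , to (∈⇔P ν) ν∈ , μ≡gν)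
              (λ { (ν , p , refl) → ∈P.∈-map⁺ g (from (∈⇔P ν) p) })

  image : ∀ {P : List ℕ → Set} (g : List ℕ → List ℕ) → (∀ {μ ν} → g μ ≡ g ν → μ ≡ ν) →
          Enumeration P → Enumeration (Image g P)
  image g g-injective (xs , exs) = map g xs , enumerates-map g g-injective exs

  enumerates-filter : ∀ {P Q : List ℕ → Set} {xs} (Q? : Decidable Q) → Enumerates P xs →
                      Enumerates (λ μ → P μ × Q μ) (filter Q? xs)
  enumerates-filter Q? (xs! , ∈⇔P) =
    UniqueP.filter⁺ Q? xs! ,
    λ μ → mk⇔ (λ μ∈ → let (μ∈xs , q) = ∈P.∈-filter⁻ Q? μ∈ in to (∈⇔P μ) μ∈xs , q)
              (λ { (p , q) → ∈P.∈-filter⁺ Q? (from (∈⇔P μ) p) q })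

  module _ {A : Set} where

    sum-map-cong : ∀ (f g : A → ℕ) xs → (∀ x → x ∈ xs → f x ≡ g x) → sum (map f xs) ≡ sum (map g xs)
    sum-map-cong f g []       f≡g = refl
    sum-map-cong f g (x ∷ xs) f≡g = cong₂ _+_ (f≡g x (here refl)) (sum-map-cong f g xs (λ y → f≡g y ∘ there))

    sum-map-++ : ∀ (f : A → ℕ) xs ys → sum (map f (xs ++ ys)) ≡ sum (map f xs) + sum (map f ys)
    sum-map-++ f xs ys = trans (cong sum (LP.map-++ f xs ys)) (SumP.sum-++ (map f xs) (map f ys))

    sum-map-const : ∀ c (xs : List A) → sum (map (λ _ → c) xs) ≡ c * length xs
    sum-map-const c []       = sym (ℕP.*-zeroʳ c)
    sum-map-const c (x ∷ xs) = trans (cong (c +_) (sum-map-const c xs)) (sym (ℕP.*-suc c (length xs)))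

    sum-map-+ : ∀ (f g : A → ℕ) xs → sum (map (λ x → f x + g x) xs) ≡ sum (map f xs) + sum (map g xs)
    sum-map-+ f g []       = refl
    sum-map-+ f g (x ∷ xs) = trans (cong (f x + g x +_) (sum-map-+ f g xs)) (interchange (f x) (g x) _ _)

  guarded : ∀ {C : Set} {P : List ℕ → Set} → Dec C → (C → Enumeration P) → Enumeration (λ μ → C × P μ)
  guarded (yes c) e = proj₁ (e c) , enumerates-⇔ (λ μ → mk⇔ (c ,_) proj₂) (proj₂ (e c))
  guarded (no ¬c) e = [] , enumerates-[] (λ μ → ¬c ∘ proj₁)

  -- The enumeration counterpart of multiplication by q^k.
  guarded≤-shift : ∀ k K {P : ℕ → List ℕ → Set} (e : ∀ K′ → Enumeration (P K′)) (F : List (List ℕ) → ℕ) →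
    F [] ≡ 0 → ℤ.+ F (proj₁ (guarded (k ≤? K) (λ _ → e (K ∸ k)))) ≡ shift k (λ K′ → ℤ.+ F (proj₁ (e K′))) K
  guarded≤-shift k K e F F[]≡0 with k ≤? K
  ... | yes k≤K = sym (shift-≥ k _ K k≤K)
  ... | no k≰K  = trans (cong ℤ.+_ F[]≡0) (sym (shift-< k _ K (ℕP.≰⇒> k≰K)))

module Partitions where

  open import Data.Nat using (ℕ; suc; _+_; _*_; _∸_; _≤_; _<_; z≤n)
  import Data.Nat.Properties as ℕP
  open import Algebra.Properties.CommutativeSemigroup ℕP.+-commutativeSemigroup using (interchange)
  open import Data.List using (List; []; _∷_; _++_; _∷ʳ_; map; length)
  import Data.List.Properties as LP
  open import Data.Nat.ListAction using (sum)
  open import Data.List.Relation.Unary.All as All using (All; []; _∷_)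
  open import Data.List.Relation.Unary.Linked using (Linked; []; [-]; _∷_)
  import Data.List.Relation.Unary.Linked.Properties as LinkedP
  open import Data.Product using (_×_; _,_)
  open import Function.Bundles using (_⇔_; mk⇔)
  open import Relation.Binary.Definitions using (Transitive)
  open import Relation.Binary.PropositionalEquality

  NonIncreasing : List ℕ → Set
  NonIncreasing = Linked (λ a b → b ≤ a)

  module _ {R : ℕ → ℕ → Set} where

    Linked⇒All-tail : Transitive R → ∀ {x ν} → Linked R (x ∷ ν) → All (R x) ν
    Linked⇒All-tail trans {ν = []}    _           = []
    Linked⇒All-tail trans {ν = _ ∷ _} (Rxy ∷ Rys) = LinkedP.Linked⇒All trans Rxy Rys

    Linked-∷ : ∀ {x ν} → All (R x) ν → Linked R ν → Linked R (x ∷ ν)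
    Linked-∷ {ν = []}    _          _   = [-]
    Linked-∷ {ν = _ ∷ _} (Rxy ∷ _) Rys = Rxy ∷ Rys

    Linked-∷ʳ : ∀ xs y → Linked R xs → All (λ x → R x y) xs → Linked R (xs ∷ʳ y)
    Linked-∷ʳ []           y _           _               = [-]
    Linked-∷ʳ (x ∷ [])     y _           (Rxy ∷ [])      = Rxy ∷ [-]
    Linked-∷ʳ (x ∷ _ ∷ xs) y (Rxx′ ∷ Rxs) (_ ∷ Rx′xs-y) = Rxx′ ∷ Linked-∷ʳ (_ ∷ xs) y Rxs Rx′xs-y

    Linked-++⁻ˡ : ∀ xs ys → Linked R (xs ++ ys) → Linked R xs
    Linked-++⁻ˡ []           ys _           = []
    Linked-++⁻ˡ (x ∷ [])     ys _           = [-]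
    Linked-++⁻ˡ (x ∷ _ ∷ xs) ys (Rxx′ ∷ Rxs) = Rxx′ ∷ Linked-++⁻ˡ (_ ∷ xs) ys Rxs

  nonIncreasing⇒All≤head : ∀ {a ν} → NonIncreasing (a ∷ ν) → All (_≤ a) ν
  nonIncreasing⇒All≤head = Linked⇒All-tail (λ b≤a c≤b → ℕP.≤-trans c≤b b≤a)

  raise : ℕ → List ℕ → List ℕ
  raise k = map (k +_)

  sum-raise : ∀ k ν → sum (raise k ν) ≡ k * length ν + sum ν
  sum-raise k []      = sym (cong (_+ 0) (ℕP.*-zeroʳ k))
  sum-raise k (x ∷ ν) = begin
      (k + x) + sum (raise k ν)
    ≡⟨ cong ((k + x) +_) (sum-raise k ν) ⟩
      (k + x) + (k * length ν + sum ν)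
    ≡⟨ interchange k x (k * length ν) (sum ν) ⟩
      (k + k * length ν) + (x + sum ν)
    ≡⟨ cong (_+ (x + sum ν)) (ℕP.*-suc k (length ν)) ⟨
      k * suc (length ν) + (x + sum ν)
    ∎
    where open ≡-Reasoning

  raise-lower : ∀ k μ → All (k ≤_) μ → raise k (map (_∸ k) μ) ≡ μ
  raise-lower k μ k≤μ = trans (sym (LP.map-∘ μ)) (LP.map-id-local (All.map ℕP.m+[n∸m]≡n k≤μ))

  raise-injective : ∀ k {μ ν} → raise k μ ≡ raise k ν → μ ≡ ν
  raise-injective k = LP.map-injective (ℕP.+-cancelˡ-≡ k _ _)

  +≡⇔≤×∸≡ : ∀ m x K → (m + x ≡ K) ⇔ (m ≤ K × x ≡ K ∸ m)
  +≡⇔≤×∸≡ m x K = mk⇔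
    (λ { refl → ℕP.m≤m+n m x , sym (ℕP.m+n∸m≡n m x) })
    (λ { (m≤K , refl) → ℕP.m+[n∸m]≡n m≤K })

  length≤sum : ∀ μ → All (0 <_) μ → length μ ≤ sum μ
  length≤sum []      []           = z≤n
  length≤sum (x ∷ μ) (0<x ∷ 0<μ) = ℕP.+-mono-≤ 0<x (length≤sum μ 0<μ)

  parts≤sum : ∀ μ → All (_≤ sum μ) μ
  parts≤sum []      = []
  parts≤sum (x ∷ μ) = ℕP.m≤m+n x (sum μ) ∷ All.map (λ y≤ → ℕP.≤-trans y≤ (ℕP.m≤n+m (sum μ) x)) (parts≤sum μ)

module OneHooks where

  open Partitions using (Linked⇒All-tail)
  open import Data.Nat as ℕ using (ℕ; zero; suc; _+_; _∸_; _≤_; _<_; z≤n; s≤s; _≤?_)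
  import Data.Nat.Properties as ℕP
  open import Data.List using (List; []; _∷_; _++_; map; filter; length; upTo; applyUpTo; zipWith; concat)
  import Data.List.Properties as LP
  open import Data.List.Relation.Unary.All as All using (All; []; _∷_)
  import Data.List.Relation.Unary.All.Properties as AllP
  open import Data.List.Relation.Unary.Linked as Linked using (Linked)
  open import Data.Product using (_×_; _,_)
  open import Data.Nat.ListAction using (sum)
  open import Function using (id; _∘_)
  open import Function.Bundles using (_⇔_; mk⇔; Equivalence)
  open import Relation.Binary.PropositionalEquality
  open import Relation.Nullary using (¬_; yes; no; contradiction)

  Cell : Set
  Cell = ℕ × ℕ × ℕ

  -- numHooks t λ is definitionally count (hookLength λ) t (cells λ).
  count : {A : Set} → (A → ℕ) → ℕ → List A → ℕ
  count h t xs = length (filter (λ x → h x ℕP.≟ t) xs)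

  δ₀ : ℕ → ℕ
  δ₀ zero    = 1
  δ₀ (suc _) = 0

  module _ {A : Set} where

    count-++ : ∀ (h : A → ℕ) t xs ys → count h t (xs ++ ys) ≡ count h t xs + count h t ys
    count-++ h t xs ys = trans (cong length (LP.filter-++ (λ x → h x ℕP.≟ t) xs ys))
                               (LP.length-++ (filter (λ x → h x ℕP.≟ t) xs))

    count-none : ∀ (h : A → ℕ) t xs → All (λ x → h x ≢ t) xs → count h t xs ≡ 0
    count-none h t xs h≢t = cong length (LP.filter-none (λ x → h x ℕP.≟ t) h≢t)

    count-[_] : ∀ x {h : A → ℕ} {c} → h x ≡ suc c → count h 1 (x ∷ []) ≡ δ₀ c
    count-[ x ] {h} {zero}  hx≡1 = cong length (LP.filter-accept (λ y → h y ℕP.≟ 1) {xs = []} hx≡1)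
    count-[ x ] {h} {suc c} hx≡2+c = cong length (LP.filter-reject (λ y → h y ℕP.≟ 1) {xs = []}
      (λ hx≡1 → ℕP.1+n≢0 (ℕP.suc-injective (trans (sym hx≡2+c) hx≡1))))

  count-map : ∀ {A B : Set} (h₁ : B → ℕ) (h₂ : A → ℕ) (f : A → B) t xs →
              All (λ x → h₁ (f x) ≡ h₂ x) xs → count h₁ t (map f xs) ≡ count h₂ t xs
  count-map h₁ h₂ f t []       []         = refl
  count-map h₁ h₂ f t (x ∷ xs) (h₁fx≡h₂x ∷ rest) with h₁ (f x) ℕP.≟ t | h₂ x ℕP.≟ t
  ... | yes p | yes q = begin
      length (filter (λ y → h₁ y ℕP.≟ t) (f x ∷ map f xs))
    ≡⟨ cong length (LP.filter-accept (λ y → h₁ y ℕP.≟ t) {xs = map f xs} p) ⟩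
      suc (count h₁ t (map f xs))
    ≡⟨ cong suc (count-map h₁ h₂ f t xs rest) ⟩
      suc (count h₂ t xs)
    ≡⟨ cong length (LP.filter-accept (λ y → h₂ y ℕP.≟ t) {xs = xs} q) ⟨
      length (filter (λ y → h₂ y ℕP.≟ t) (x ∷ xs))
    ∎
    where open ≡-Reasoning
  ... | no ¬p | no ¬q = begin
      length (filter (λ y → h₁ y ℕP.≟ t) (f x ∷ map f xs))
    ≡⟨ cong length (LP.filter-reject (λ y → h₁ y ℕP.≟ t) {xs = map f xs} ¬p) ⟩
      count h₁ t (map f xs)
    ≡⟨ count-map h₁ h₂ f t xs rest ⟩
      count h₂ t xs
    ≡⟨ cong length (LP.filter-reject (λ y → h₂ y ℕP.≟ t) {xs = xs} ¬q) ⟨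
      length (filter (λ y → h₂ y ℕP.≟ t) (x ∷ xs))
    ∎
    where open ≡-Reasoning
  ... | yes p | no ¬q = contradiction (trans (sym h₁fx≡h₂x) p) ¬q
  ... | no ¬p | yes q = contradiction (trans h₁fx≡h₂x q) ¬p

  sum-δ₀ : ∀ {A : Set} (h : A → ℕ) xs → sum (map (δ₀ ∘ h) xs) ≡ count h 0 xs
  sum-δ₀ h []       = refl
  sum-δ₀ h (x ∷ xs) with h x ℕP.≟ 0
  ... | yes hx≡0 = begin
      δ₀ (h x) + sum (map (δ₀ ∘ h) xs)
    ≡⟨ cong₂ _+_ (cong δ₀ hx≡0) (sum-δ₀ h xs) ⟩
      suc (count h 0 xs)
    ≡⟨ cong length (LP.filter-accept (λ y → h y ℕP.≟ 0) {xs = xs} hx≡0) ⟨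
      count h 0 (x ∷ xs)
    ∎
    where open ≡-Reasoning
  ... | no hx≢0 = begin
      δ₀ (h x) + sum (map (δ₀ ∘ h) xs)
    ≡⟨ cong₂ _+_ (δ₀-≢0 hx≢0) (sum-δ₀ h xs) ⟩
      count h 0 xs
    ≡⟨ cong length (LP.filter-reject (λ y → h y ℕP.≟ 0) {xs = xs} hx≢0) ⟨
      count h 0 (x ∷ xs)
    ∎
    where
    open ≡-Reasoning
    δ₀-≢0 : ∀ {n} → n ≢ 0 → δ₀ n ≡ 0
    δ₀-≢0 {zero}  0≢0 = contradiction refl 0≢0
    δ₀-≢0 {suc n} _   = refl

  conj-∷-≤ : ∀ j a ν → j ≤ a → conj (a ∷ ν) j ≡ suc (conj ν j)
  conj-∷-≤ j a ν j≤a = cong length (LP.filter-accept (j ≤?_) {xs = ν} j≤a)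

  conj-∷-> : ∀ j a ν → a < j → conj (a ∷ ν) j ≡ conj ν j
  conj-∷-> j a ν a<j = cong length (LP.filter-reject (j ≤?_) {xs = ν} (ℕP.<⇒≱ a<j))

  conj≡0⇔All≤ : ∀ b ν → conj ν (suc b) ≡ 0 ⇔ All (_≤ b) ν
  conj≡0⇔All≤ b ν = mk⇔ (to ν) (from ν)
    where
    to : ∀ ν → conj ν (suc b) ≡ 0 → All (_≤ b) ν
    to []      _ = []
    to (c ∷ ν) conj≡0 with suc b ≤? c
    ... | yes b<c = contradiction (trans (sym (conj-∷-≤ (suc b) c ν b<c)) conj≡0) ℕP.1+n≢0
    ... | no b≮c  = ℕP.≤-pred (ℕP.≰⇒> b≮c) ∷ to ν (trans (sym (conj-∷-> (suc b) c ν (ℕP.≰⇒> b≮c))) conj≡0)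
    from : ∀ ν → All (_≤ b) ν → conj ν (suc b) ≡ 0
    from []      []          = refl
    from (c ∷ ν) (c≤b ∷ ν≤b) = trans (conj-∷-> (suc b) c ν (s≤s c≤b)) (from ν ν≤b)

  row : ℕ → ℕ → List Cell
  row i a = map (λ j → (suc i , a , suc j)) (upTo a)

  -- cells ν is definitionally cellsFrom id ν.
  cellsFrom : (ℕ → ℕ) → List ℕ → List Cell
  cellsFrom g ν = concat (zipWith row (applyUpTo g (length ν)) ν)

  lowerCell : Cell → Cell
  lowerCell (i , b , j) = (suc i , b , j)

  cellsFrom-suc : ∀ g ν → cellsFrom (λ x → suc (g x)) ν ≡ map lowerCell (cellsFrom g ν)
  cellsFrom-suc g []      = refl
  cellsFrom-suc g (b ∷ ν) = begin
      row (suc (g 0)) b ++ cellsFrom (λ x → suc (g (suc x))) ν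
    ≡⟨ cong₂ _++_ (LP.map-∘ (upTo b)) (cellsFrom-suc (λ x → g (suc x)) ν) ⟩
      map lowerCell (row (g 0) b) ++ map lowerCell (cellsFrom (λ x → g (suc x)) ν)
    ≡⟨ LP.map-++ lowerCell (row (g 0) b) _ ⟨
      map lowerCell (row (g 0) b ++ cellsFrom (λ x → g (suc x)) ν)
    ∎
    where open ≡-Reasoning

  cells-∷ : ∀ a ν → cells (a ∷ ν) ≡ row 0 a ++ map lowerCell (cells ν)
  cells-∷ a ν = cong (row 0 a ++_) (cellsFrom-suc id ν)

  InRowsBelow : ℕ → Cell → Set
  InRowsBelow a (i , b , j) = 1 ≤ j × j ≤ b × b ≤ a

  cellsFrom-inRowsBelow : ∀ a g ν → All (_≤ a) ν → All (InRowsBelow a) (cellsFrom g ν)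
  cellsFrom-inRowsBelow a g []      []          = []
  cellsFrom-inRowsBelow a g (b ∷ ν) (b≤a ∷ ν≤a) =
    AllP.++⁺ (AllP.map⁺ (AllP.applyUpTo⁺₁ id b (λ j<b → s≤s z≤n , j<b , b≤a)))
             (cellsFrom-inRowsBelow a (λ x → g (suc x)) ν ν≤a)

  hookLength-lowerCell : ∀ a ν c → InRowsBelow a c → hookLength (a ∷ ν) (lowerCell c) ≡ hookLength ν c
  hookLength-lowerCell a ν (i , b , j) (_ , j≤b , b≤a) = begin
      (b + conj (a ∷ ν) j + 1) ∸ (suc i + j)
    ≡⟨ cong (λ z → (b + z + 1) ∸ (suc i + j)) (conj-∷-≤ j a ν (ℕP.≤-trans j≤b b≤a)) ⟩
      (b + suc (conj ν j) + 1) ∸ (suc i + j)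
    ≡⟨ cong (λ z → (z + 1) ∸ (suc i + j)) (ℕP.+-suc b (conj ν j)) ⟩
      (b + conj ν j + 1) ∸ (i + j)
    ∎
    where open ≡-Reasoning

  hookLength-firstRow : ∀ a ν j → j ≤ a →
    hookLength (suc a ∷ ν) (1 , suc a , suc j) ≡ suc ((a ∸ j) + conj ν (suc j))
  hookLength-firstRow a ν j j≤a = begin
      (suc a + conj (suc a ∷ ν) (suc j) + 1) ∸ (1 + suc j)
    ≡⟨ cong (λ z → (suc a + z + 1) ∸ (1 + suc j)) (conj-∷-≤ (suc j) (suc a) ν (s≤s j≤a)) ⟩
      (suc a + suc c + 1) ∸ (1 + suc j)
    ≡⟨ cong (λ z → (z + 1) ∸ suc j) (ℕP.+-suc a c) ⟩
      (a + c + 1) ∸ j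
    ≡⟨ cong (_∸ j) (ℕP.+-assoc a c 1) ⟩
      (a + (c + 1)) ∸ j
    ≡⟨ ℕP.+-∸-comm (c + 1) j≤a ⟩
      (a ∸ j) + (c + 1)
    ≡⟨ cong ((a ∸ j) +_) (ℕP.+-comm c 1) ⟩
      (a ∸ j) + suc c
    ≡⟨ ℕP.+-suc (a ∸ j) c ⟩
      suc ((a ∸ j) + c)
    ∎
    where
    open ≡-Reasoning
    c : ℕ
    c = conj ν (suc j)

  firstRow-oneHooks : ∀ a ν → count (hookLength (suc a ∷ ν)) 1 (row 0 (suc a)) ≡ δ₀ (conj ν (suc a))
  firstRow-oneHooks a ν = begin
      count H 1 (row 0 (suc a))
    ≡⟨ count-map H φ (λ j → (1 , suc a , suc j)) 1 (upTo (suc a)) (AllP.applyUpTo⁺₂ id (suc a) (λ _ → refl)) ⟩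
      count φ 1 (upTo (suc a))
    ≡⟨ cong (count φ 1) (LP.upTo-∷ʳ a) ⟨
      count φ 1 (upTo a ++ a ∷ [])
    ≡⟨ count-++ φ 1 (upTo a) (a ∷ []) ⟩
      count φ 1 (upTo a) + count φ 1 (a ∷ [])
    ≡⟨ cong₂ _+_ (count-none φ 1 (upTo a) (AllP.applyUpTo⁺₁ id a φ≢1)) (count-[ a ] {φ} φa≡1+conj) ⟩
      δ₀ (conj ν (suc a))
    ∎
    where
    open ≡-Reasoning
    H : Cell → ℕ
    H = hookLength (suc a ∷ ν)
    φ : ℕ → ℕ
    φ j = H (1 , suc a , suc j)
    φ≢1 : ∀ {j} → j < a → φ j ≢ 1
    φ≢1 {j} j<a φj≡1 = ℕP.m>n⇒m∸n≢0 j<a (ℕP.m+n≡0⇒m≡0 (a ∸ j)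
      (ℕP.suc-injective (trans (sym (hookLength-firstRow a ν j (ℕP.<⇒≤ j<a))) φj≡1)))
    φa≡1+conj : φ a ≡ suc (conj ν (suc a))
    φa≡1+conj = trans (hookLength-firstRow a ν a ℕP.≤-refl) (cong (λ z → suc (z + conj ν (suc a))) (ℕP.n∸n≡0 a))

  numHooks₁-∷ : ∀ a ν → All (_≤ suc a) ν → numHooks 1 (suc a ∷ ν) ≡ δ₀ (conj ν (suc a)) + numHooks 1 ν
  numHooks₁-∷ a ν ν≤1+a = begin
      count H 1 (cells (suc a ∷ ν))
    ≡⟨ cong (count H 1) (cells-∷ (suc a) ν) ⟩
      count H 1 (row 0 (suc a) ++ map lowerCell (cells ν))
    ≡⟨ count-++ H 1 (row 0 (suc a)) (map lowerCell (cells ν)) ⟩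
      count H 1 (row 0 (suc a)) + count H 1 (map lowerCell (cells ν))
    ≡⟨ cong₂ _+_ (firstRow-oneHooks a ν)
         (count-map H (hookLength ν) lowerCell 1 (cells ν)
            (All.map (hookLength-lowerCell (suc a) ν _) (cellsFrom-inRowsBelow (suc a) id ν ν≤1+a))) ⟩
      δ₀ (conj ν (suc a)) + numHooks 1 ν
    ∎
    where
    open ≡-Reasoning
    H : Cell → ℕ
    H = hookLength (suc a ∷ ν)

  numHooks₁-strict : ∀ μ → All (0 <_) μ → Linked (λ a b → b < a) μ → numHooks 1 μ ≡ length μ
  numHooks₁-strict []            []              _      = refl
  numHooks₁-strict (suc a ∷ ν) (_ ∷ ν>0) μ-strict = begin
      numHooks 1 (suc a ∷ ν)
    ≡⟨ numHooks₁-∷ a ν (All.map ℕP.m≤n⇒m≤1+n ν≤a) ⟩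
      δ₀ (conj ν (suc a)) + numHooks 1 ν
    ≡⟨ cong₂ _+_ (cong δ₀ (Equivalence.from (conj≡0⇔All≤ a ν) ν≤a))
                 (numHooks₁-strict ν ν>0 (Linked.tail μ-strict)) ⟩
      suc (length ν)
    ∎
    where
    open ≡-Reasoning
    ν≤a : All (_≤ a) ν
    ν≤a = All.map ℕP.≤-pred (Linked⇒All-tail (λ y<x z<y → ℕP.<-trans z<y y<x) μ-strict)

module GapPartitions where

  open Partitions
  open Enumeration
  open import Data.Nat using (ℕ; zero; suc; _+_; _*_; _∸_; _≤_; _<_; z≤n; s≤s; _≤?_)
  import Data.Nat.Properties as ℕP
  open import Data.Nat.Induction using (<-rec)
  open import Data.List using (List; []; _∷_; _++_; _∷ʳ_; map; length)
  import Data.List.Properties as LP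
  open import Data.Nat.ListAction using (sum)
  import Data.Nat.ListAction.Properties as SumP
  open import Data.List.Relation.Unary.All as All using (All; []; _∷_)
  import Data.List.Relation.Unary.All.Properties as AllP
  open import Data.List.Relation.Unary.Linked as Linked using (Linked; []; _∷_)
  import Data.List.Relation.Unary.Linked.Properties as LinkedP
  open import Data.List.Relation.Unary.Any using (here)
  import Data.List.Membership.Propositional.Properties as ∈P
  open import Data.Product using (∃; _×_; _,_; proj₁; proj₂)
  open import Data.Sum using (_⊎_; inj₁; inj₂; [_,_])
  open import Function using (_∘_)
  open import Function.Bundles using (_⇔_; mk⇔; Equivalence)
  open import Function.Properties.Equivalence using () renaming (sym to ⇔-sym)
  open import Relation.Binary.PropositionalEquality hiding ([_])
  open import Relation.Nullary using (¬_)
  open import Data.List.Membership.Propositional using (_∈_)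

  open Equivalence

  GapPartition : ℕ → ℕ → List ℕ → Set
  GapPartition n K μ = (IsPartitionOf K μ × Gap2 μ) × length μ ≡ n

  appendOne : List ℕ → List ℕ
  appendOne ν = raise 2 ν ∷ʳ 1

  AllRaised : ℕ → ℕ → List ℕ → Set
  AllRaised n K μ = suc n ≤ K × Image (raise 1) (GapPartition (suc n) (K ∸ suc n)) μ

  OneAppended : ℕ → ℕ → List ℕ → Set
  OneAppended n K μ = suc (2 * n) ≤ K × Image appendOne (GapPartition n (K ∸ suc (2 * n))) μ

  length-appendOne : ∀ ν → length (appendOne ν) ≡ suc (length ν)
  length-appendOne ν = trans (LP.length-++ (raise 2 ν)) (trans (ℕP.+-comm _ 1) (cong suc (LP.length-map (2 +_) ν)))

  sum-appendOne : ∀ ν → sum (appendOne ν) ≡ suc (2 * length ν + sum ν)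
  sum-appendOne ν = trans (SumP.sum-++ (raise 2 ν) (1 ∷ [])) (trans (ℕP.+-comm _ 1) (cong suc (sum-raise 2 ν)))

  appendOne-injective : ∀ {μ ν} → appendOne μ ≡ appendOne ν → μ ≡ ν
  appendOne-injective {μ} {ν} eq = raise-injective 2 (proj₁ (LP.∷ʳ-injective (raise 2 μ) (raise 2 ν) eq))

  raise1-gapPartition : ∀ {n K ν} → suc n ≤ K → GapPartition (suc n) (K ∸ suc n) ν → GapPartition (suc n) K (raise 1 ν)
  raise1-gapPartition {n} {K} {ν} n<K (((0<ν , ν↘ , Σν) , ν-gap) , ∣ν∣) =
    ((AllP.map⁺ (All.map (λ _ → s≤s z≤n) 0<ν) , LinkedP.map⁺ (Linked.map s≤s ν↘) , Σraise) ,
     LinkedP.map⁺ (Linked.map s≤s ν-gap)) ,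
    trans (LP.length-map suc ν) ∣ν∣
    where
    Σraise : sum (raise 1 ν) ≡ K
    Σraise = trans (sum-raise 1 ν) (trans (cong₂ _+_ (trans (ℕP.*-identityˡ _) ∣ν∣) refl)
                                          (from (+≡⇔≤×∸≡ (suc n) (sum ν) K) (n<K , Σν)))

  raise1-gapPartition⁻¹ : ∀ {n K ν} → All (0 <_) ν → GapPartition (suc n) K (raise 1 ν) →
                          suc n ≤ K × GapPartition (suc n) (K ∸ suc n) ν
  raise1-gapPartition⁻¹ {n} {K} {ν} 0<ν (((_ , μ↘ , Σμ) , μ-gap) , ∣μ∣) =
    proj₁ split , ((0<ν , Linked.map ℕP.≤-pred (LinkedP.map⁻ μ↘) , proj₂ split) ,
                   Linked.map ℕP.≤-pred (LinkedP.map⁻ μ-gap)) , ∣ν∣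
    where
    ∣ν∣ : length ν ≡ suc n
    ∣ν∣ = trans (sym (LP.length-map suc ν)) ∣μ∣
    split : suc n ≤ K × sum ν ≡ K ∸ suc n
    split = to (+≡⇔≤×∸≡ (suc n) (sum ν) K)
      (trans (cong (_+ sum ν) (trans (sym ∣ν∣) (sym (ℕP.*-identityˡ _)))) (trans (sym (sum-raise 1 ν)) Σμ))

  appendOne-gapPartition : ∀ {n K ν} → suc (2 * n) ≤ K → GapPartition n (K ∸ suc (2 * n)) ν →
                           GapPartition (suc n) K (appendOne ν)
  appendOne-gapPartition {n} {K} {ν} 2n<K (((0<ν , ν↘ , Σν) , ν-gap) , ∣ν∣) =
    ((AllP.++⁺ (AllP.map⁺ (All.map (λ _ → s≤s z≤n) 0<ν)) (s≤s z≤n ∷ []) ,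
      Linked-∷ʳ (raise 2 ν) 1 (LinkedP.map⁺ (Linked.map (s≤s ∘ s≤s) ν↘))
                              (AllP.map⁺ (All.map (λ _ → s≤s z≤n) 0<ν)) ,
      Σappend) ,
     Linked-∷ʳ (raise 2 ν) 1 (LinkedP.map⁺ (Linked.map (s≤s ∘ s≤s) ν-gap)) (AllP.map⁺ (All.map (s≤s ∘ s≤s) 0<ν))) ,
    trans (length-appendOne ν) (cong suc ∣ν∣)
    where
    Σappend : sum (appendOne ν) ≡ K
    Σappend = trans (sum-appendOne ν) (trans (cong (λ l → suc (2 * l + sum ν)) ∣ν∣)
                                            (from (+≡⇔≤×∸≡ (suc (2 * n)) (sum ν) K) (2n<K , Σν)))

  appendOne-gapPartition⁻¹ : ∀ {n K ν} → All (0 <_) ν → GapPartition (suc n) K (appendOne ν) →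
                             suc (2 * n) ≤ K × GapPartition n (K ∸ suc (2 * n)) ν
  appendOne-gapPartition⁻¹ {n} {K} {ν} 0<ν (((_ , μ↘ , Σμ) , μ-gap) , ∣μ∣) =
    proj₁ split ,
    ((0<ν , Linked.map (ℕP.≤-pred ∘ ℕP.≤-pred) (lower μ↘) , proj₂ split) ,
     Linked.map (ℕP.≤-pred ∘ ℕP.≤-pred) (lower μ-gap)) ,
    ∣ν∣
    where
    lower : ∀ {R : ℕ → ℕ → Set} → Linked (λ a b → R b a) (appendOne ν) → Linked (λ a b → R (2 + b) (2 + a)) ν
    lower = LinkedP.map⁻ ∘ Linked-++⁻ˡ (raise 2 ν) (1 ∷ [])
    ∣ν∣ : length ν ≡ n
    ∣ν∣ = ℕP.suc-injective (trans (sym (length-appendOne ν)) ∣μ∣)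
    split : suc (2 * n) ≤ K × sum ν ≡ K ∸ suc (2 * n)
    split = to (+≡⇔≤×∸≡ (suc (2 * n)) (sum ν) K)
      (trans (cong (λ l → suc (2 * l + sum ν)) (sym ∣ν∣)) (trans (sym (sum-appendOne ν)) Σμ))

  smallestPart-split : ∀ a μ → 0 < a → All (0 <_) μ → Gap2 (a ∷ μ) →
                       All (2 ≤_) (a ∷ μ) ⊎ ∃ λ ρ → a ∷ μ ≡ ρ ∷ʳ 1 × All (3 ≤_) ρ
  smallestPart-split 1             []      _   _            _             = inj₂ ([] , refl , [])
  smallestPart-split (suc (suc a)) []      _   _            _             = inj₁ (s≤s (s≤s z≤n) ∷ [])
  smallestPart-split a             (b ∷ μ) 0<a (0<b ∷ 0<μ) (b+2≤a ∷ gap) with smallestPart-split b μ 0<b 0<μ gap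
  ... | inj₁ 2≤bμ            = inj₁ (ℕP.≤-trans (ℕP.m≤n+m 2 b) b+2≤a ∷ 2≤bμ)
  ... | inj₂ (ρ , bμ≡ρ1 , 3≤ρ) =
    inj₂ (a ∷ ρ , cong (a ∷_) bμ≡ρ1 , ℕP.≤-trans (ℕP.+-monoˡ-≤ 2 0<b) b+2≤a ∷ 3≤ρ)

  lower-positive : ∀ k μ → All (suc k ≤_) μ → All (0 <_) (map (_∸ k) μ)
  lower-positive k μ k<μ = AllP.map⁺ (All.map ℕP.m<n⇒0<n∸m k<μ)

  gapPartition-allRaised : ∀ {n K μ} → All (2 ≤_) μ → GapPartition (suc n) K μ → AllRaised n K μ
  gapPartition-allRaised {n} {K} {μ} 2≤μ p = proj₁ lowered , map (_∸ 1) μ , proj₂ lowered , μ≡ν+1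
    where
    μ≡ν+1 : μ ≡ raise 1 (map (_∸ 1) μ)
    μ≡ν+1 = sym (raise-lower 1 μ (All.map (ℕP.≤-trans (s≤s z≤n)) 2≤μ))
    lowered : suc n ≤ K × GapPartition (suc n) (K ∸ suc n) (map (_∸ 1) μ)
    lowered = raise1-gapPartition⁻¹ (lower-positive 1 μ 2≤μ) (subst (GapPartition (suc n) K) μ≡ν+1 p)

  gapPartition-oneAppended : ∀ {n K μ} ρ → μ ≡ ρ ∷ʳ 1 → All (3 ≤_) ρ → GapPartition (suc n) K μ → OneAppended n K μ
  gapPartition-oneAppended {n} {K} {μ} ρ μ≡ρ1 3≤ρ p = proj₁ lowered , map (_∸ 2) ρ , proj₂ lowered , μ≡ν↑
    where
    μ≡ν↑ : μ ≡ appendOne (map (_∸ 2) ρ)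
    μ≡ν↑ = trans μ≡ρ1 (cong (_∷ʳ 1) (sym (raise-lower 2 ρ (All.map (ℕP.≤-trans (ℕP.n≤1+n 2)) 3≤ρ))))
    lowered : suc (2 * n) ≤ K × GapPartition n (K ∸ suc (2 * n)) (map (_∸ 2) ρ)
    lowered = appendOne-gapPartition⁻¹ (lower-positive 2 ρ 3≤ρ) (subst (GapPartition (suc n) K) μ≡ν↑ p)

  gapPartition-suc⇔ : ∀ n K μ → GapPartition (suc n) K μ ⇔ (AllRaised n K μ ⊎ OneAppended n K μ)
  gapPartition-suc⇔ n K μ = mk⇔ (decompose μ) [ (λ { (n<K , ν , p , refl) → raise1-gapPartition n<K p })
                                              , (λ { (2n<K , ν , p , refl) → appendOne-gapPartition 2n<K p }) ]
    where
    decompose : ∀ μ → GapPartition (suc n) K μ → AllRaised n K μ ⊎ OneAppended n K μ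
    decompose []      (_ , ())
    decompose (a ∷ μ) p@(((0<a ∷ 0<μ , _) , gap) , _) with smallestPart-split a μ 0<a 0<μ gap
    ... | inj₁ 2≤aμ               = inj₁ (gapPartition-allRaised 2≤aμ p)
    ... | inj₂ (ρ , aμ≡ρ1 , 3≤ρ) = inj₂ (gapPartition-oneAppended ρ aμ≡ρ1 3≤ρ p)

  allRaised-oneAppended-disjoint : ∀ n K μ → AllRaised n K μ → ¬ OneAppended n K μ
  allRaised-oneAppended-disjoint n K μ (_ , ν , (((0<ν , _) , _) , _) , refl) (_ , ν′ , _ , ν+1≡ν′↑) =
    ℕP.<-irrefl refl (All.lookup (AllP.map⁺ {P = 2 ≤_} (All.map s≤s 0<ν))
                                 (subst (1 ∈_) (sym ν+1≡ν′↑) (∈P.∈-++⁺ʳ (raise 2 ν′) (here refl))))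

  gapPartitions-zero : ∀ K → Enumeration (GapPartition 0 K)
  gapPartitions-zero zero    =
    ([] ∷ []) , enumerates-[ [] ] (λ μ → mk⇔ (only-empty μ) λ { refl → (([] , [] , refl) , []) , refl })
    where
    only-empty : ∀ μ → GapPartition 0 0 μ → μ ≡ []
    only-empty []      _       = refl
    only-empty (_ ∷ _) (_ , ())
  gapPartitions-zero (suc K) = [] , enumerates-[] λ { [] (((_ , _ , ()) , _) , _) ; (_ ∷ _) (_ , ()) }

  gapPartitions-suc : ∀ n K → Enumeration (AllRaised n K) → Enumeration (OneAppended n K) →
                      Enumeration (GapPartition (suc n) K)
  gapPartitions-suc n K (xs , exs) (ys , eys) =
    xs ++ ys , enumerates-⇔ (λ μ → ⇔-sym (gapPartition-suc⇔ n K μ))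
                            (enumerates-++ exs eys (allRaised-oneAppended-disjoint n K))

  allRaised : ∀ n K → (suc n ≤ K → Enumeration (GapPartition (suc n) (K ∸ suc n))) → Enumeration (AllRaised n K)
  allRaised n K e = guarded (suc n ≤? K) (image (raise 1) (raise-injective 1) ∘ e)

  oneAppended : ∀ n K → (suc (2 * n) ≤ K → Enumeration (GapPartition n (K ∸ suc (2 * n)))) →
                Enumeration (OneAppended n K)
  oneAppended n K e = guarded (suc (2 * n) ≤? K) (image appendOne appendOne-injective ∘ e)

  gapPartitions : ∀ K n → Enumeration (GapPartition n K)
  gapPartitions = <-rec (λ K → ∀ n → Enumeration (GapPartition n K)) step
    where
    step : ∀ K → (∀ {K′} → K′ < K → ∀ n → Enumeration (GapPartition n K′)) → ∀ n → Enumeration (GapPartition n K)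
    step K rec zero    = gapPartitions-zero K
    step K rec (suc n) = gapPartitions-suc n K
      (allRaised n K (λ n<K → rec (ℕP.∸-monoʳ-< (s≤s z≤n) n<K) (suc n)))
      (oneAppended n K (λ 2n<K → rec (ℕP.∸-monoʳ-< (s≤s z≤n) 2n<K) n))

module GapPartitionCounts where

  open PowerSeries
  open Partitions
  open Enumeration
  open OneHooks using (numHooks₁-strict)
  open GapPartitions
  open import Data.Nat as ℕ using (ℕ; zero; suc; _∸_; _≤_; _<_; z≤n; s≤s)
  import Data.Nat.Properties as ℕP
  open import Data.Nat.Tactic.RingSolver using (solve-∀)
  open import Data.Integer using (+_) renaming (_+_ to _+ᶻ_; _*_ to _*ᶻ_)
  import Data.Integer.Properties as ℤP
  open import Data.List using (List; []; _++_; map; length)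
  import Data.List.Properties as LP
  open import Data.Nat.ListAction using (sum)
  open import Data.List.Relation.Unary.All using (All)
  open import Data.List.Relation.Unary.Linked as Linked using (Linked)
  open import Data.Product using (_×_; _,_; proj₁; proj₂)
  open import Data.Sum using (_⊎_; inj₁; inj₂)
  open import Function.Bundles using (mk⇔; Equivalence)
  open import Relation.Binary.PropositionalEquality

  open Equivalence

  gapCount : ℕ → Series
  gapCount n K = + length (proj₁ (gapPartitions K n))

  gapCount-zero : gapCount 0 ≗ one
  gapCount-zero K = trans (cong +_ (enumerates-length (proj₂ (gapPartitions K 0)) (proj₂ (gapPartitions-zero K)))) (base K)
    where
    base : ∀ K → + length (proj₁ (gapPartitions-zero K)) ≡ one K
    base zero    = refl
    base (suc K) = refl

  gapCount-suc : ∀ n → gapCount (suc n) ≗ (shift (suc (2 ℕ.* n)) (gapCount n) +ₛ (+ 1 ·ₛ shift (suc n) (gapCount (suc n))))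
  gapCount-suc n K = begin
      + length (proj₁ (gapPartitions K (suc n)))
    ≡⟨ cong +_ (enumerates-length (proj₂ (gapPartitions K (suc n))) (proj₂ decomposition)) ⟩
      + length (xs ++ ys)
    ≡⟨ cong +_ (LP.length-++ xs) ⟩
      + (length xs ℕ.+ length ys)
    ≡⟨ ℤP.pos-+ (length xs) (length ys) ⟩
      + length xs +ᶻ + length ys
    ≡⟨ ℤP.+-comm (+ length xs) (+ length ys) ⟩
      + length ys +ᶻ + length xs
    ≡⟨ cong₂ _+ᶻ_ (count-image (suc (2 ℕ.* n)) n appendOne appendOne-injective)
                  (count-image (suc n) (suc n) (raise 1) (raise-injective 1)) ⟩
      shift (suc (2 ℕ.* n)) (gapCount n) K +ᶻ shift (suc n) (gapCount (suc n)) K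
    ≡⟨ cong (shift (suc (2 ℕ.* n)) (gapCount n) K +ᶻ_) (sym (ℤP.*-identityˡ _)) ⟩
      shift (suc (2 ℕ.* n)) (gapCount n) K +ᶻ + 1 *ᶻ shift (suc n) (gapCount (suc n)) K
    ∎
    where
    open ≡-Reasoning
    decomposition : Enumeration (GapPartition (suc n) K)
    decomposition = gapPartitions-suc n K (allRaised n K (λ _ → gapPartitions (K ∸ suc n) (suc n)))
                                          (oneAppended n K (λ _ → gapPartitions (K ∸ suc (2 ℕ.* n)) n))
    xs ys : List (List ℕ)
    xs = proj₁ (allRaised n K (λ _ → gapPartitions (K ∸ suc n) (suc n)))
    ys = proj₁ (oneAppended n K (λ _ → gapPartitions (K ∸ suc (2 ℕ.* n)) n))
    count-image : ∀ k m g (g-inj : ∀ {μ ν} → g μ ≡ g ν → μ ≡ ν) →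
      + length (proj₁ (guarded (k ℕ.≤? K) (λ _ → image g g-inj (gapPartitions (K ∸ k) m)))) ≡ shift k (gapCount m) K
    count-image k m g g-inj = trans (guarded≤-shift k K (λ K′ → image g g-inj (gapPartitions K′ m)) length refl)
                                    (shift-cong k (λ K′ → cong +_ (LP.length-map g (proj₁ (gapPartitions K′ m)))) K)

  gapSeries : ℕ → Series
  gapSeries n = shift (n ℕ.* n) (inv (qq n))

  qq-coeff-zero : ∀ n → qq n 0 ≡ + 1
  qq-coeff-zero n = prodₛ-coeff-zero n _ (λ i → factor-coeff-zero (+ 1) (1 ℕ.* i))

  inv-qq-suc : ∀ n → inv (qq (suc n)) ≗ (inv (qq n) +ₛ (+ 1 ·ₛ shift (suc n) (inv (qq (suc n)))))
  inv-qq-suc n = *ₛ-factor⇒recurrence (+ 1) (suc n) (λ K → begin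
      (inv (qq (suc n)) *ₛ factor (+ 1) (suc n)) K
    ≡⟨ *ₛ-congʳ (inv (qq (suc n))) (λ j → cong (λ k → factor (+ 1) (suc k) j) (ℕP.*-identityˡ n)) K ⟨
      (inv (qq n *ₛ factor (+ 1) (suc (1 ℕ.* n))) *ₛ factor (+ 1) (suc (1 ℕ.* n))) K
    ≡⟨ inv-*ₛ-cancelʳ (qq n) (factor (+ 1) (suc (1 ℕ.* n))) (qq-coeff-zero n) (factor-coeff-zero (+ 1) (1 ℕ.* n)) K ⟩
      inv (qq n) K
    ∎)
    where open ≡-Reasoning

  square-suc : ∀ n → suc n ℕ.* suc n ≡ suc (2 ℕ.* n) ℕ.+ n ℕ.* n
  square-suc = solve-∀

  gapSeries-suc : ∀ n → gapSeries (suc n) ≗ (shift (suc (2 ℕ.* n)) (gapSeries n) +ₛ (+ 1 ·ₛ shift (suc n) (gapSeries (suc n))))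
  gapSeries-suc n K = begin
      shift (m ℕ.* m) (inv (qq m)) K
    ≡⟨ shift-cong (m ℕ.* m) (inv-qq-suc n) K ⟩
      shift (m ℕ.* m) (inv (qq n) +ₛ (+ 1 ·ₛ shift m (inv (qq m)))) K
    ≡⟨ shift-+ₛ (m ℕ.* m) (inv (qq n)) _ K ⟩
      shift (m ℕ.* m) (inv (qq n)) K +ᶻ shift (m ℕ.* m) (+ 1 ·ₛ shift m (inv (qq m))) K
    ≡⟨ cong₂ _+ᶻ_ first (shift-·ₛ (m ℕ.* m) (+ 1) (shift m (inv (qq m))) K) ⟩
      shift (suc (2 ℕ.* n)) (gapSeries n) K +ᶻ + 1 *ᶻ shift (m ℕ.* m) (shift m (inv (qq m))) K
    ≡⟨ cong (λ z → shift (suc (2 ℕ.* n)) (gapSeries n) K +ᶻ + 1 *ᶻ z) second ⟩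
      shift (suc (2 ℕ.* n)) (gapSeries n) K +ᶻ + 1 *ᶻ shift m (gapSeries m) K
    ∎
    where
    open ≡-Reasoning
    m : ℕ
    m = suc n
    first : shift (m ℕ.* m) (inv (qq n)) K ≡ shift (suc (2 ℕ.* n)) (gapSeries n) K
    first = trans (cong (λ k → shift k (inv (qq n)) K) (square-suc n)) (sym (shift-shift (suc (2 ℕ.* n)) (n ℕ.* n) _ K))
    second : shift (m ℕ.* m) (shift m (inv (qq m))) K ≡ shift m (gapSeries m) K
    second = trans (shift-shift (m ℕ.* m) m _ K)
             (trans (cong (λ k → shift k (inv (qq m)) K) (ℕP.+-comm (m ℕ.* m) m)) (sym (shift-shift m (m ℕ.* m) _ K)))

  gapCount≗gapSeries : ∀ n → gapCount n ≗ gapSeries n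
  gapCount≗gapSeries zero    K = trans (gapCount-zero K) (sym (inv-one K))
  gapCount≗gapSeries (suc n) = shift-recurrence-unique n (+ 1) (shift (suc (2 ℕ.* n)) (gapCount n))
    (gapCount (suc n)) (gapSeries (suc n)) (gapCount-suc n)
    (λ K → trans (gapSeries-suc n K)
      (cong (_+ᶻ + 1 *ᶻ shift (suc n) (gapSeries (suc n)) K)
            (sym (shift-cong (suc (2 ℕ.* n)) (gapCount≗gapSeries n) K))))

  GapPartitionOf : ℕ → List ℕ → Set
  GapPartitionOf N μ = IsPartitionOf N μ × Gap2 μ

  gap2-oneHooks : ∀ μ → All (0 <_) μ → Gap2 μ → numHooks 1 μ ≡ length μ
  gap2-oneHooks μ 0<μ gap =
    numHooks₁-strict μ 0<μ (Linked.map (λ {a} {b} b+2≤a → ℕP.<-≤-trans (ℕP.m<m+n b (s≤s z≤n)) b+2≤a) gap)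

  gapPartitionsShorterThan : ∀ N m → Enumeration (λ μ → GapPartitionOf N μ × length μ < m)
  gapPartitionsShorterThan N zero    = [] , enumerates-[] (λ { μ (_ , ()) })
  gapPartitionsShorterThan N (suc m) =
    proj₁ shorter ++ proj₁ (gapPartitions N m) ,
    enumerates-⇔ (λ μ → mk⇔ merge (split μ))
                 (enumerates-++ (proj₂ shorter) (proj₂ (gapPartitions N m))
                                (λ μ (_ , ∣μ∣<m) (_ , ∣μ∣≡m) → ℕP.<⇒≢ ∣μ∣<m ∣μ∣≡m))
    where
    shorter : Enumeration (λ μ → GapPartitionOf N μ × length μ < m)
    shorter = gapPartitionsShorterThan N m
    merge : ∀ {μ} → (GapPartitionOf N μ × length μ < m) ⊎ GapPartition m N μ → GapPartitionOf N μ × length μ < suc m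
    merge (inj₁ (p , ∣μ∣<m))  = p , ℕP.m≤n⇒m≤1+n ∣μ∣<m
    merge (inj₂ (p , refl)) = p , ℕP.≤-refl
    split : ∀ μ → GapPartitionOf N μ × length μ < suc m → (GapPartitionOf N μ × length μ < m) ⊎ GapPartition m N μ
    split μ (p , ∣μ∣<1+m) with ℕP.m≤n⇒m<n∨m≡n (ℕP.≤-pred ∣μ∣<1+m)
    ... | inj₁ ∣μ∣<m = inj₁ (p , ∣μ∣<m)
    ... | inj₂ ∣μ∣≡m = inj₂ (p , ∣μ∣≡m)

  oneHooks-shorterThan : ∀ N m → + sum (map (numHooks 1) (proj₁ (gapPartitionsShorterThan N m)))
                                  ≡ sumBelow m (λ n → + n *ᶻ gapCount n N)
  oneHooks-shorterThan N zero    = refl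
  oneHooks-shorterThan N (suc m) = begin
      + sum (map (numHooks 1) (xs ++ ys))
    ≡⟨ cong +_ (sum-map-++ (numHooks 1) xs ys) ⟩
      + (sum (map (numHooks 1) xs) ℕ.+ sum (map (numHooks 1) ys))
    ≡⟨ ℤP.pos-+ (sum (map (numHooks 1) xs)) _ ⟩
      + sum (map (numHooks 1) xs) +ᶻ + sum (map (numHooks 1) ys)
    ≡⟨ cong₂ _+ᶻ_ (oneHooks-shorterThan N m) (cong +_ all-length-m) ⟩
      sumBelow m (λ n → + n *ᶻ gapCount n N) +ᶻ + (m ℕ.* length ys)
    ≡⟨ cong (sumBelow m (λ n → + n *ᶻ gapCount n N) +ᶻ_) (ℤP.pos-* m (length ys)) ⟩
      sumBelow m (λ n → + n *ᶻ gapCount n N) +ᶻ + m *ᶻ gapCount m N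
    ≡⟨ sumBelow-suc m (λ n → + n *ᶻ gapCount n N) ⟨
      sumBelow (suc m) (λ n → + n *ᶻ gapCount n N)
    ∎
    where
    open ≡-Reasoning
    xs ys : List (List ℕ)
    xs = proj₁ (gapPartitionsShorterThan N m)
    ys = proj₁ (gapPartitions N m)
    all-length-m : sum (map (numHooks 1) ys) ≡ m ℕ.* length ys
    all-length-m = trans (sum-map-cong (numHooks 1) (λ _ → m) ys λ μ μ∈ys →
                     let (((0<μ , _) , gap) , ∣μ∣≡m) = to (proj₂ (proj₂ (gapPartitions N m)) μ) μ∈ys
                     in trans (gap2-oneHooks μ 0<μ gap) ∣μ∣≡m)
                   (sum-map-const m ys)

  gapPartitions-oneHooks : ∀ N Ls → Enumerates (GapPartitionOf N) Ls → + sum (map (numHooks 1) Ls) ≡ rhs1 N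
  gapPartitions-oneHooks N Ls eLs = begin
      + sum (map (numHooks 1) Ls)
    ≡⟨ cong +_ (enumerates-sum (enumerates-⇔ (λ μ → mk⇔ (λ p → p , length<1+N p) proj₁) eLs)
                               (proj₂ (gapPartitionsShorterThan N (suc N))) (numHooks 1)) ⟩
      + sum (map (numHooks 1) (proj₁ (gapPartitionsShorterThan N (suc N))))
    ≡⟨ oneHooks-shorterThan N (suc N) ⟩
      sumBelow (suc N) (λ n → + n *ᶻ gapCount n N)
    ≡⟨ sumBelow-cong (suc N) (λ n _ → trans (cong (+ n *ᶻ_) (gapCount≗gapSeries n N))
                                            (sym (mono-*ₛ (+ n) (n ℕ.* n) (inv (qq n)) N))) ⟩
      sumBelow (suc N) (λ n → (mono (+ n) (n ℕ.* n) *ₛ inv (qq n)) N)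
    ≡⟨ sumℤ-map-upTo (λ n → (mono (+ n) (n ℕ.* n) *ₛ inv (qq n)) N) (suc N) ⟨
      rhs1 N
    ∎
    where
    open ≡-Reasoning
    length<1+N : ∀ {μ} → GapPartitionOf N μ → length μ < suc N
    length<1+N {μ} ((0<μ , _ , Σμ≡N) , _) = s≤s (subst (length μ ≤_) Σμ≡N (length≤sum μ 0<μ))

module RestrictedPartitions {S : ℕ → Set} (S? : Decidable S) where

  open PowerSeries
  open Partitions
  open Enumeration
  open OneHooks using (δ₀; count; sum-δ₀; conj≡0⇔All≤; numHooks₁-∷)
  open import Data.Nat as ℕ using (zero; suc; _∸_; _≤_; _<_; z≤n; s≤s; _≤?_)
  import Data.Nat.Properties as ℕP
  open import Data.Nat.Induction using (<-rec)
  open import Data.Integer using (ℤ; +_) renaming (_+_ to _+ᶻ_; _*_ to _*ᶻ_)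
  import Data.Integer.Properties as ℤP
  open import Data.Integer.Tactic.RingSolver using (solve-∀)
  open import Data.List using (List; []; _∷_; _++_; map)
  import Data.List.Properties as LP
  open import Data.List.Properties using (∷-injectiveʳ)
  open import Data.Nat.ListAction using (sum)
  open import Data.List.Relation.Unary.All as All using (All; []; _∷_)
  open import Data.List.Relation.Unary.Linked as Linked using (Linked; [])
  open import Data.Product using (_×_; _,_; proj₁; proj₂)
  open import Data.Sum using (_⊎_; inj₁; inj₂; [_,_])
  open import Function using (_∘_)
  open import Function.Bundles using (_⇔_; mk⇔; Equivalence)
  open import Function.Properties.Equivalence using () renaming (sym to ⇔-sym)
  open import Relation.Binary.PropositionalEquality hiding ([_])
  open import Relation.Nullary using (¬_; yes; no; contradiction)

  open Equivalence

  RestrictedPartition : ℕ → ℕ → List ℕ → Set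
  RestrictedPartition K b μ = (IsPartitionOf K μ × All S μ) × All (_≤ b) μ

  WithLargestPart : ℕ → ℕ → List ℕ → Set
  WithLargestPart K b μ = S (suc b) × suc b ≤ K × Image (suc b ∷_) (RestrictedPartition (K ∸ suc b) (suc b)) μ

  restrictedPartition-suc⇔ : ∀ K b μ → RestrictedPartition K (suc b) μ ⇔ (RestrictedPartition K b μ ⊎ WithLargestPart K b μ)
  restrictedPartition-suc⇔ K b μ = mk⇔ (decompose μ) [ (λ (p , μ≤b) → p , All.map ℕP.m≤n⇒m≤1+n μ≤b) , compose ]
    where
    decompose : ∀ μ → RestrictedPartition K (suc b) μ → RestrictedPartition K b μ ⊎ WithLargestPart K b μ
    decompose []      (p , [])            = inj₁ (p , [])
    decompose (a ∷ ν) (p@((0<aν , aν↘ , Σaν) , Saν) , a≤1+b ∷ ν≤1+b) with a ≤? b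
    ... | yes a≤b = inj₁ (p , a≤b ∷ All.map (λ c≤a → ℕP.≤-trans c≤a a≤b) (nonIncreasing⇒All≤head aν↘))
    ... | no a≰b with ℕP.≤-antisym a≤1+b (ℕP.≰⇒> a≰b)
    ...   | refl with 0<aν | Saν
    ...     | _ ∷ 0<ν | S1+b ∷ Sν =
      let (1+b≤K , Σν) = to (+≡⇔≤×∸≡ (suc b) (sum ν) K) Σaν
      in inj₂ (S1+b , 1+b≤K , ν , (((0<ν , Linked.tail aν↘ , Σν) , Sν) , ν≤1+b) , refl)
    compose : WithLargestPart K b μ → RestrictedPartition K (suc b) μ
    compose (S1+b , 1+b≤K , ν , (((0<ν , ν↘ , Σν) , Sν) , ν≤1+b) , refl) =
      ((s≤s z≤n ∷ 0<ν , Linked-∷ ν≤1+b ν↘ , from (+≡⇔≤×∸≡ (suc b) (sum ν) K) (1+b≤K , Σν)) , S1+b ∷ Sν) ,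
      ℕP.≤-refl ∷ ν≤1+b

  bounded-withLargestPart-disjoint : ∀ K b μ → RestrictedPartition K b μ → ¬ WithLargestPart K b μ
  bounded-withLargestPart-disjoint K b μ (_ , 1+b≤b ∷ _) (_ , _ , ν , _ , refl) = ℕP.<-irrefl refl 1+b≤b

  restrictedPartitions-zero : ∀ K → Enumeration (RestrictedPartition K 0)
  restrictedPartitions-zero zero    =
    ([] ∷ []) , enumerates-[ [] ] (λ μ → mk⇔ (only-empty μ) λ { refl → (([] , [] , refl) , []) , [] })
    where
    only-empty : ∀ μ → RestrictedPartition 0 0 μ → μ ≡ []
    only-empty []      _                                = refl
    only-empty (a ∷ _) (((0<a ∷ _ , _) , _) , a≤0 ∷ _) = contradiction a≤0 (ℕP.<⇒≱ 0<a)
  restrictedPartitions-zero (suc K) = [] , enumerates-[] λ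
    { [] (((_ , _ , ()) , _) , _)
    ; (a ∷ _) (((0<a ∷ _ , _) , _) , a≤0 ∷ _) → ℕP.<⇒≱ 0<a a≤0 }

  restrictedPartitions-suc : ∀ K b → Enumeration (RestrictedPartition K b) → Enumeration (WithLargestPart K b) →
                             Enumeration (RestrictedPartition K (suc b))
  restrictedPartitions-suc K b (xs , exs) (ys , eys) =
    xs ++ ys , enumerates-⇔ (λ μ → ⇔-sym (restrictedPartition-suc⇔ K b μ))
                            (enumerates-++ exs eys (bounded-withLargestPart-disjoint K b))

  withLargestPart : ∀ K b → (suc b ≤ K → Enumeration (RestrictedPartition (K ∸ suc b) (suc b))) →
                    Enumeration (WithLargestPart K b)
  withLargestPart K b e = guarded (S? (suc b)) λ _ →
    guarded (suc b ≤? K) (image (suc b ∷_) ∷-injectiveʳ ∘ e)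

  restrictedPartitions : ∀ K b → Enumeration (RestrictedPartition K b)
  restrictedPartitions = <-rec (λ K → ∀ b → Enumeration (RestrictedPartition K b)) step
    where
    step : ∀ K → (∀ {K′} → K′ < K → ∀ b → Enumeration (RestrictedPartition K′ b)) →
           ∀ b → Enumeration (RestrictedPartition K b)
    step K rec zero    = restrictedPartitions-zero K
    step K rec (suc b) = restrictedPartitions-suc K b (step K rec b)
      (withLargestPart K b (λ b<K → rec (ℕP.∸-monoʳ-< (s≤s z≤n) b<K) (suc b)))

  indicator : ℕ → ℤ
  indicator a with S? a
  ... | yes _ = + 1
  ... | no _  = + 0

  indicator-cong : ∀ {a a′} → (S a → S a′) → (S a′ → S a) → indicator a ≡ indicator a′
  indicator-cong {a} {a′} to from with S? a | S? a′
  ... | yes _  | yes _   = refl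
  ... | no _   | no _    = refl
  ... | yes Sa | no ¬Sa′ = contradiction (to Sa) ¬Sa′
  ... | no ¬Sa | yes Sa′ = contradiction (from Sa′) ¬Sa

  guarded-indicator : ∀ a {P : List ℕ → Set} (E : Enumeration P) (F : List (List ℕ) → ℕ) → F [] ≡ 0 →
                      + F (proj₁ (guarded (S? a) (λ _ → E))) ≡ indicator a *ᶻ + F (proj₁ E)
  guarded-indicator a E F F[]≡0 with S? a
  ... | yes _ = sym (ℤP.*-identityˡ _)
  ... | no _  = cong +_ F[]≡0

  weight : (List ℕ → ℕ) → ℕ → Series
  weight f b K = + sum (map f (proj₁ (restrictedPartitions K b)))

  weight-suc : ∀ f b → weight f (suc b) ≗
    (weight f b +ₛ (indicator (suc b) ·ₛ shift (suc b) (weight (f ∘ (suc b ∷_)) (suc b))))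
  weight-suc f b K = begin
      + sum (map f (proj₁ (restrictedPartitions K (suc b))))
    ≡⟨ cong +_ (enumerates-sum (proj₂ (restrictedPartitions K (suc b))) (proj₂ decomposition) f) ⟩
      + sum (map f (xs ++ ys))
    ≡⟨ cong +_ (sum-map-++ f xs ys) ⟩
      + (sum (map f xs) ℕ.+ sum (map f ys))
    ≡⟨ ℤP.pos-+ (sum (map f xs)) (sum (map f ys)) ⟩
      weight f b K +ᶻ + sum (map f ys)
    ≡⟨ cong (weight f b K +ᶻ_) (guarded-indicator (suc b) bounded (sum ∘ map f) refl) ⟩
      weight f b K +ᶻ indicator (suc b) *ᶻ + sum (map f (proj₁ bounded))
    ≡⟨ cong (λ z → weight f b K +ᶻ indicator (suc b) *ᶻ z) (trans
         (guarded≤-shift (suc b) K (λ K′ → image (suc b ∷_) ∷-injectiveʳ (restrictedPartitions K′ (suc b)))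
                         (sum ∘ map f) refl)
         (shift-cong (suc b) (λ K′ → cong (+_ ∘ sum) (sym (LP.map-∘ (proj₁ (restrictedPartitions K′ (suc b)))))) K)) ⟩
      weight f b K +ᶻ indicator (suc b) *ᶻ shift (suc b) (weight (f ∘ (suc b ∷_)) (suc b)) K
    ∎
    where
    open ≡-Reasoning
    bounded : Enumeration (λ μ → suc b ≤ K × Image (suc b ∷_) (RestrictedPartition (K ∸ suc b) (suc b)) μ)
    bounded = guarded (suc b ≤? K) (λ _ → image (suc b ∷_) ∷-injectiveʳ (restrictedPartitions (K ∸ suc b) (suc b)))
    decomposition : Enumeration (RestrictedPartition K (suc b))
    decomposition = restrictedPartitions-suc K b (restrictedPartitions K b)
                      (withLargestPart K b (λ _ → restrictedPartitions (K ∸ suc b) (suc b)))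
    xs ys : List (List ℕ)
    xs = proj₁ (restrictedPartitions K b)
    ys = proj₁ (withLargestPart K b (λ _ → restrictedPartitions (K ∸ suc b) (suc b)))

  partitionCount : ℕ → Series
  partitionCount = weight (λ _ → 1)

  oneHookCount : ℕ → Series
  oneHookCount = weight (numHooks 1)

  partitionCount-zero : partitionCount 0 ≗ one
  partitionCount-zero K = trans (cong +_ (enumerates-sum (proj₂ (restrictedPartitions K 0)) (proj₂ (restrictedPartitions-zero K)) _))
                                (base K)
    where
    base : ∀ K → + sum (map (λ _ → 1) (proj₁ (restrictedPartitions-zero K))) ≡ one K
    base zero    = refl
    base (suc K) = refl

  oneHookCount-zero : oneHookCount 0 ≗ zeroₛ
  oneHookCount-zero K = cong +_ (trans (enumerates-sum (proj₂ (restrictedPartitions K 0)) (proj₂ (restrictedPartitions-zero K)) _)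
                                       (base K))
    where
    base : ∀ K → sum (map (numHooks 1) (proj₁ (restrictedPartitions-zero K))) ≡ 0
    base zero    = refl
    base (suc K) = refl

  partitionCount-suc : ∀ b →
    partitionCount (suc b) ≗ (partitionCount b +ₛ (indicator (suc b) ·ₛ shift (suc b) (partitionCount (suc b))))
  partitionCount-suc = weight-suc (λ _ → 1)

  oneHooks-withLargestPart : ∀ b → weight (numHooks 1 ∘ (suc b ∷_)) (suc b) ≗ (partitionCount b +ₛ oneHookCount (suc b))
  oneHooks-withLargestPart b K = begin
      + sum (map (numHooks 1 ∘ (suc b ∷_)) νs)
    ≡⟨ cong +_ (sum-map-cong _ _ νs λ ν ν∈ →
         numHooks₁-∷ b ν (proj₂ (to (proj₂ (proj₂ (restrictedPartitions K (suc b))) ν) ν∈))) ⟩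
      + sum (map (λ ν → δ₀ (conj ν (suc b)) ℕ.+ numHooks 1 ν) νs)
    ≡⟨ cong +_ (sum-map-+ (δ₀ ∘ (λ ν → conj ν (suc b))) (numHooks 1) νs) ⟩
      + (sum (map (δ₀ ∘ (λ ν → conj ν (suc b))) νs) ℕ.+ sum (map (numHooks 1) νs))
    ≡⟨ ℤP.pos-+ (sum (map (δ₀ ∘ (λ ν → conj ν (suc b))) νs)) (sum (map (numHooks 1) νs)) ⟩
      + sum (map (δ₀ ∘ (λ ν → conj ν (suc b))) νs) +ᶻ oneHookCount (suc b) K
    ≡⟨ cong (λ n → + n +ᶻ oneHookCount (suc b) K) (trans (sum-δ₀ (λ ν → conj ν (suc b)) νs) bounded-by-b) ⟩
      partitionCount b K +ᶻ oneHookCount (suc b) K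
    ∎
    where
    open ≡-Reasoning
    νs : List (List ℕ)
    νs = proj₁ (restrictedPartitions K (suc b))
    bounded-by-b : count (λ ν → conj ν (suc b)) 0 νs ≡ sum (map (λ _ → 1) (proj₁ (restrictedPartitions K b)))
    bounded-by-b = trans
      (enumerates-length {P = RestrictedPartition K b}
        (enumerates-⇔ (λ μ → mk⇔ (λ ((p , μ≤1+b) , conj≡0) → p , to (conj≡0⇔All≤ b μ) conj≡0)
                                 (λ (p , μ≤b) → (p , All.map ℕP.m≤n⇒m≤1+n μ≤b) , from (conj≡0⇔All≤ b μ) μ≤b))
                      (enumerates-filter (λ ν → conj ν (suc b) ℕP.≟ 0) (proj₂ (restrictedPartitions K (suc b)))))
        (proj₂ (restrictedPartitions K b)))
      (sym (trans (sum-map-const 1 (proj₁ (restrictedPartitions K b))) (ℕP.*-identityˡ _)))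

  oneHookCount-suc : ∀ b → oneHookCount (suc b) ≗
    (oneHookCount b +ₛ (indicator (suc b) ·ₛ shift (suc b) (partitionCount b +ₛ oneHookCount (suc b))))
  oneHookCount-suc b K = trans (weight-suc (numHooks 1) b K)
    (cong (λ z → oneHookCount b K +ᶻ indicator (suc b) *ᶻ z) (shift-cong (suc b) (oneHooks-withLargestPart b) K))

  partsProduct : ℕ → Series
  partsProduct b = prodₛ b (λ i → factor (indicator (suc i)) (suc i))

  allowedParts : ℕ → Series
  allowedParts zero    = zeroₛ
  allowedParts (suc b) = allowedParts b +ₛ mono (indicator (suc b)) (suc b)

  partsProduct-coeff-zero : ∀ b → partsProduct b 0 ≡ + 1
  partsProduct-coeff-zero b = prodₛ-coeff-zero b _ (λ i → factor-coeff-zero (indicator (suc i)) i)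

  inv-partsProduct-*ₛ-factor : ∀ b →
    (inv (partsProduct (suc b)) *ₛ factor (indicator (suc b)) (suc b)) ≗ inv (partsProduct b)
  inv-partsProduct-*ₛ-factor b = inv-*ₛ-cancelʳ (partsProduct b) (factor (indicator (suc b)) (suc b))
    (partsProduct-coeff-zero b) (factor-coeff-zero (indicator (suc b)) b)

  partitionCount≗inv-partsProduct : ∀ b → partitionCount b ≗ inv (partsProduct b)
  partitionCount≗inv-partsProduct zero    K = trans (partitionCount-zero K) (sym (inv-one K))
  partitionCount≗inv-partsProduct (suc b) = shift-recurrence-unique b c (inv (partsProduct b))
    (partitionCount (suc b)) (inv (partsProduct (suc b)))
    (λ K → trans (partitionCount-suc b K)
      (cong (_+ᶻ c *ᶻ shift (suc b) (partitionCount (suc b)) K) (partitionCount≗inv-partsProduct b K)))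
    (*ₛ-factor⇒recurrence c (suc b) (inv-partsProduct-*ₛ-factor b))
    where
    c : ℤ
    c = indicator (suc b)

  oneHookCount≗ : ∀ b → oneHookCount b ≗ (inv (partsProduct b) *ₛ allowedParts b)
  oneHookCount≗ zero    K = trans (oneHookCount-zero K)
    (sym (trans (*ₛ-comm (inv (partsProduct 0)) zeroₛ K) (*ₛ-zeroˡ (inv (partsProduct 0)) K)))
  oneHookCount≗ (suc b) = shift-recurrence-unique b c Y (oneHookCount (suc b)) (Q′ *ₛ allowedParts (suc b))
    (λ K → trans (oneHookCount-suc b K) (trans
      (cong (λ z → oneHookCount b K +ᶻ c *ᶻ z) (shift-+ₛ (suc b) (partitionCount b) (oneHookCount (suc b)) K))
      (regroup (oneHookCount b K) c _ _)))
    (*ₛ-factor⇒recurrence c (suc b) λ K → begin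
        ((Q′ *ₛ T′) *ₛ F) K
      ≡⟨ *ₛ-assoc Q′ T′ F K ⟩
        (Q′ *ₛ (T′ *ₛ F)) K
      ≡⟨ *ₛ-congʳ Q′ (*ₛ-comm T′ F) K ⟩
        (Q′ *ₛ (F *ₛ T′)) K
      ≡⟨ *ₛ-assoc Q′ F T′ K ⟨
        ((Q′ *ₛ F) *ₛ T′) K
      ≡⟨ *ₛ-congˡ T′ (inv-partsProduct-*ₛ-factor b) K ⟩
        (Q *ₛ (allowedParts b +ₛ mono c (suc b))) K
      ≡⟨ *ₛ-distribˡ-+ₛ Q (allowedParts b) (mono c (suc b)) K ⟩
        (Q *ₛ allowedParts b) K +ᶻ (Q *ₛ mono c (suc b)) K
      ≡⟨ cong ((Q *ₛ allowedParts b) K +ᶻ_) (trans (*ₛ-comm Q (mono c (suc b)) K) (mono-*ₛ c (suc b) Q K)) ⟩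
        (Q *ₛ allowedParts b) K +ᶻ c *ᶻ shift (suc b) Q K
      ≡⟨ cong₂ (λ x y → x +ᶻ c *ᶻ y) (oneHookCount≗ b K)
               (shift-cong (suc b) (partitionCount≗inv-partsProduct b) K) ⟨
        Y K
      ∎)
    where
    open ≡-Reasoning
    c : ℤ
    c = indicator (suc b)
    F Q Q′ T′ : Series
    F = factor c (suc b)
    Q = inv (partsProduct b)
    Q′ = inv (partsProduct (suc b))
    T′ = allowedParts (suc b)
    Y : Series
    Y = oneHookCount b +ₛ (c ·ₛ shift (suc b) (partitionCount b))
    regroup : ∀ a c x y → a +ᶻ c *ᶻ (x +ᶻ y) ≡ (a +ᶻ c *ᶻ x) +ᶻ c *ᶻ y
    regroup = solve-∀

  restrictedPartitions-oneHooks : ∀ N Ls → Enumerates (λ μ → IsPartitionOf N μ × All S μ) Ls →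
                                  + sum (map (numHooks 1) Ls) ≡ (inv (partsProduct N) *ₛ allowedParts N) N
  restrictedPartitions-oneHooks N Ls eLs = trans
    (cong +_ (enumerates-sum (enumerates-⇔ (λ μ → mk⇔ (λ p → p , parts≤N p) proj₁) eLs)
                             (proj₂ (restrictedPartitions N N)) (numHooks 1)))
    (oneHookCount≗ N N)
    where
    parts≤N : ∀ {μ} → IsPartitionOf N μ × All S μ → All (_≤ N) μ
    parts≤N {μ} ((_ , _ , Σμ≡N) , _) = subst (λ n → All (_≤ n) μ) Σμ≡N (parts≤sum μ)

  partsProduct-stable : ∀ b k → k ≤ b → partsProduct b k ≡ partsProduct k k
  partsProduct-stable zero    zero z≤n  = refl
  partsProduct-stable (suc b) k    k≤1+b with ℕP.m≤n⇒m<n∨m≡n k≤1+b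
  ... | inj₂ refl  = refl
  ... | inj₁ k<1+b = trans (*ₛ-factor-below (partsProduct b) (indicator (suc b)) (suc b) k k<1+b)
                           (partsProduct-stable b k (ℕP.≤-pred k<1+b))

  indicatorSeries : Series
  indicatorSeries zero    = + 0
  indicatorSeries (suc k) = indicator (suc k)

  allowedParts-above : ∀ b k → b < k → allowedParts b k ≡ + 0
  allowedParts-above zero    k _     = refl
  allowedParts-above (suc b) k 1+b<k = cong₂ _+ᶻ_ (allowedParts-above b k (ℕP.<-trans (ℕP.n<1+n b) 1+b<k))
                                                 (mono-≢ (indicator (suc b)) (suc b) k (ℕP.>⇒≢ 1+b<k))

  allowedParts-coeff : ∀ b k → k ≤ b → allowedParts b k ≡ indicatorSeries k
  allowedParts-coeff zero    zero z≤n  = refl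
  allowedParts-coeff (suc b) k    k≤1+b with ℕP.m≤n⇒m<n∨m≡n k≤1+b
  ... | inj₁ k<1+b = trans (cong₂ _+ᶻ_ (allowedParts-coeff b k (ℕP.≤-pred k<1+b))
                                       (mono-≢ (indicator (suc b)) (suc b) k (ℕP.<⇒≢ k<1+b)))
                           (ℤP.+-identityʳ _)
  ... | inj₂ refl  = trans (cong₂ _+ᶻ_ (allowedParts-above b (suc b) (ℕP.n<1+n b)) (mono-≡ (indicator (suc b)) (suc b)))
                           (ℤP.+-identityˡ _)

module Residue14Partitions where

  open PowerSeries
  open import Data.Nat as ℕ using (ℕ; zero; suc; _%_; _≤_; s≤s)
  import Data.Nat.Properties as ℕP
  open import Data.Nat.DivMod using ([m+kn]%n≡m%n)
  open import Data.Integer using (+_) renaming (_+_ to _+ᶻ_; _*_ to _*ᶻ_; _-_ to _-ᶻ_)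
  import Data.Integer.Properties as ℤP
  open import Data.List using (map)
  open import Data.Nat.ListAction using (sum)
  open import Data.Sum using (_⊎_)
  open import Data.Product using (_×_)
  open import Relation.Binary.PropositionalEquality
  open import Relation.Nullary.Decidable using (_⊎-dec_)
  open import Relation.Unary using (Decidable)

  OneOrFour : ℕ → Set
  OneOrFour r = r ≡ 1 ⊎ r ≡ 4

  Residue14 : ℕ → Set
  Residue14 a = OneOrFour (a % 5)

  residue14? : Decidable Residue14
  residue14? a = (a % 5 ℕP.≟ 1) ⊎-dec (a % 5 ℕP.≟ 4)

  open RestrictedPartitions residue14?

  indicator-periodic : ∀ r m → indicator (r ℕ.+ m ℕ.* 5) ≡ indicator r
  indicator-periodic r m = indicator-cong (subst OneOrFour r+5m≡r) (subst OneOrFour (sym r+5m≡r))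
    where
    r+5m≡r : (r ℕ.+ m ℕ.* 5) % 5 ≡ r % 5
    r+5m≡r = [m+kn]%n≡m%n r m 5

  indicatorSeries≡indicator : ∀ k → indicatorSeries k ≡ indicator k
  indicatorSeries≡indicator zero    = refl
  indicatorSeries≡indicator (suc k) = refl

  indicatorSeries-*ₛ-factor : (factor (+ 1) 5 *ₛ indicatorSeries) ≗ (mono (+ 1) 1 +ₛ mono (+ 1) 4)
  indicatorSeries-*ₛ-factor k = trans (*ₛ-comm (factor (+ 1) 5) indicatorSeries k)
                                      (trans (*ₛ-factor indicatorSeries (+ 1) 5 k) (coeff k))
    where
    coeff : ∀ k → indicatorSeries k -ᶻ + 1 *ᶻ shift 5 indicatorSeries k ≡ mono (+ 1) 1 k +ᶻ mono (+ 1) 4 k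
    coeff 0 = refl
    coeff 1 = refl
    coeff 2 = refl
    coeff 3 = refl
    coeff 4 = refl
    coeff (suc (suc (suc (suc (suc j))))) = begin
        indicator (5 ℕ.+ j) -ᶻ + 1 *ᶻ indicatorSeries j
      ≡⟨ cong₂ (λ x y → x -ᶻ y) (trans (cong indicator (ℕP.+-comm 5 j)) (indicator-periodic j 1))
                               (trans (ℤP.*-identityˡ _) (indicatorSeries≡indicator j)) ⟩
        indicator j -ᶻ indicator j
      ≡⟨ ℤP.+-inverseʳ (indicator j) ⟩
        + 0
      ≡⟨ cong₂ _+ᶻ_ (mono-≢ (+ 1) 1 (5 ℕ.+ j) (λ ())) (mono-≢ (+ 1) 4 (5 ℕ.+ j) (λ ())) ⟨
        mono (+ 1) 1 (5 ℕ.+ j) +ᶻ mono (+ 1) 4 (5 ℕ.+ j)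
      ∎
      where open ≡-Reasoning

  indicatorSeries≗ : indicatorSeries ≗ ((mono (+ 1) 1 +ₛ mono (+ 1) 4) *ₛ inv (factor (+ 1) 5))
  indicatorSeries≗ k = trans (inv-solve (factor (+ 1) 5) indicatorSeries _ (factor-coeff-zero (+ 1) 4) indicatorSeries-*ₛ-factor k)
                             (*ₛ-comm (inv (factor (+ 1) 5)) (mono (+ 1) 1 +ₛ mono (+ 1) 4) k)

  -- Of the factors for the parts 5m+1, …, 5m+5 only those for 5m+1 and 5m+4 are nontrivial.
  partsProduct≗qPoch : ∀ m → partsProduct (m ℕ.* 5) ≗ (qPoch 1 5 m *ₛ qPoch 4 5 m)
  partsProduct≗qPoch zero    n = sym (*ₛ-identityˡ one n)
  partsProduct≗qPoch (suc m) n = begin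
      (((((X *ₛ F 0) *ₛ F 1) *ₛ F 2) *ₛ F 3) *ₛ F 4) n
    ≡⟨ *ₛ-factor-trivial ((((X *ₛ F 0) *ₛ F 1) *ₛ F 2) *ₛ F 3) (5 ℕ.+ m ℕ.* 5) (indicator-periodic 5 m) n ⟩
      ((((X *ₛ F 0) *ₛ F 1) *ₛ F 2) *ₛ F 3) n
    ≡⟨ *ₛ-congˡ (F 3) (λ j → trans (*ₛ-factor-trivial ((X *ₛ F 0) *ₛ F 1) (3 ℕ.+ m ℕ.* 5) (indicator-periodic 3 m) j)
                                   (*ₛ-factor-trivial (X *ₛ F 0) (2 ℕ.+ m ℕ.* 5) (indicator-periodic 2 m) j)) n ⟩
      ((X *ₛ F 0) *ₛ F 3) n
    ≡⟨ *ₛ-congˡ (F 3) (*ₛ-congˡ (F 0) (partsProduct≗qPoch m)) n ⟩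
      (((qPoch 1 5 m *ₛ qPoch 4 5 m) *ₛ F 0) *ₛ F 3) n
    ≡⟨ *ₛ-interchange (qPoch 1 5 m) (qPoch 4 5 m) (F 0) (F 3) n ⟩
      ((qPoch 1 5 m *ₛ F 0) *ₛ (qPoch 4 5 m *ₛ F 3)) n
    ≡⟨ cong₂ (λ F₀ F₃ → ((qPoch 1 5 m *ₛ F₀) *ₛ (qPoch 4 5 m *ₛ F₃)) n) (F≡qFactor 1 refl) (F≡qFactor 4 refl) ⟩
      (qPoch 1 5 (suc m) *ₛ qPoch 4 5 (suc m)) n
    ∎
    where
    open ≡-Reasoning
    X : Series
    X = partsProduct (m ℕ.* 5)
    F : ℕ → Series
    F i = factor (indicator (suc i ℕ.+ m ℕ.* 5)) (suc i ℕ.+ m ℕ.* 5)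
    F≡qFactor : ∀ r → indicator r ≡ + 1 →
                factor (indicator (r ℕ.+ m ℕ.* 5)) (r ℕ.+ m ℕ.* 5) ≡ factor (+ 1) (r ℕ.+ 5 ℕ.* m)
    F≡qFactor r ind≡1 = cong₂ factor (trans (indicator-periodic r m) ind≡1) (cong (r ℕ.+_) (ℕP.*-comm m 5))

  partsProduct≗qPochInf-below : ∀ N j → j ≤ N → partsProduct N j ≡ (qPochInf 1 5 *ₛ qPochInf 4 5) j
  partsProduct≗qPochInf-below N j j≤N = begin
      partsProduct N j
    ≡⟨ partsProduct-stable N j j≤N ⟩
      partsProduct j j
    ≡⟨ partsProduct-stable (M ℕ.* 5) j j≤5M ⟨
      partsProduct (M ℕ.* 5) j
    ≡⟨ partsProduct≗qPoch M j ⟩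
      (qPoch 1 5 M *ₛ qPoch 4 5 M) j
    ≡⟨ *ₛ-local j (λ i i≤j → qPoch-stable 1 4 M i (s≤s (ℕP.≤-trans i≤j j≤N)))
                  (λ i i≤j → qPoch-stable 4 4 M i (s≤s (ℕP.≤-trans i≤j j≤N))) ⟩
      (qPochInf 1 5 *ₛ qPochInf 4 5) j
    ∎
    where
    open ≡-Reasoning
    M : ℕ
    M = suc N
    j≤5M : j ≤ M ℕ.* 5
    j≤5M = ℕP.≤-trans j≤N (ℕP.≤-trans (ℕP.n≤1+n N) (ℕP.m≤m*n M 5))

  residue14Partitions-oneHooks : ∀ N Ls → Enumerates (λ μ → IsPartitionOf N μ × Parts14mod5 μ) Ls →
                                 + sum (map (numHooks 1) Ls) ≡ rhs2 N
  residue14Partitions-oneHooks N Ls eLs = begin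
      + sum (map (numHooks 1) Ls)
    ≡⟨ restrictedPartitions-oneHooks N Ls eLs ⟩
      (inv (partsProduct N) *ₛ allowedParts N) N
    ≡⟨ *ₛ-local N (inv-local N (λ j j≤N → partsProduct≗qPochInf-below N j j≤N))
                  (λ k k≤N → trans (allowedParts-coeff N k k≤N) (indicatorSeries≗ k)) ⟩
      rhs2 N
    ∎
    where open ≡-Reasoning

open GapPartitionCounts using (gapPartitions-oneHooks)
open Residue14Partitions using (residue14Partitions-oneHooks)
open import Data.Integer using (+_)
open import Data.List using (List; map)
open import Data.Nat.ListAction using (sum)
open import Data.Product using (_×_; _,_)
open import Relation.Binary.PropositionalEquality using (_≡_)

proposition3p1 :
    ((N : ℕ) (Ls : List (List ℕ)) →
      Enumerates (λ μ → IsPartitionOf N μ × Gap2 μ) Ls →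
      + sum (map (numHooks 1) Ls) ≡ rhs1 N)
    × ((N : ℕ) (Ls : List (List ℕ)) →
      Enumerates (λ μ → IsPartitionOf N μ × Parts14mod5 μ) Ls →
      + sum (map (numHooks 1) Ls) ≡ rhs2 N)
proposition3p1 = gapPartitions-oneHooks , residue14Partitions-oneHooks
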